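{- Let $k\geq 2$ and $n\geq 3k$, and let $\tilde{C}_{n;k}$ be the graph with vertices $v_1,\dots,v_n$ obtained from the cycle $v_1v_2\cdots v_nv_1$ by replacing each of the $2k$ consecutive edges $v_iv_{i+1}$, $1\leq i\leq 2k$, by $k+1$ parallel edges and each of the remaining edges by $k$ parallel edges. Then $\tilde{C}_{n;k}$ is $(2k+1)$-scramble minimal.
   Context: Graphs are finite, with multiple edges allowed but no loops. Smoothing a degree-$2$ vertex $u$ with edges to distinct vertices $v,w$ replaces $u$ and its two edges by an edge $vw$; $H$ is a topological minor of $G$ if obtainable from $G$ by deleting vertices, deleting edges and smoothing vertices. An egg is a nonempty vertex subset inducing a connected subgraph; a scramble $\mathcal{S}$ is a collection of eggs; $h(\mathcal{S})$ is the minimum size of a vertex set meeting every egg; an egg-cut is an edge set whose deletion disconnects the graph into two components each containing an egg, and $e(\mathcal{S})$ is the minimum size of an egg-cut ($\infty$ if none); $\|\mathcal{S}\|=\min\{h(\mathcal{S}),e(\mathcal{S})\}$; $\mathrm{sn}(G)$ is the maximum order of a scramble on $G$. $G$ is $m$-scramble minimal if $\mathrm{sn}(G)\geq m$ and every proper topological minor $H$ of $G$ has $\mathrm{sn}(H)<m$. -}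

module Defs where

open import Data.Nat using (ℕ; zero; suc; _+_; _*_; _≤_; _<?_)
open import Data.Fin using (Fin; toℕ; fromℕ<; punchOut) renaming (zero to fzero)
open import Data.Fin.Properties using (_≟_)
open import Data.Fin.Subset using (Subset; _∈_; _∉_; Nonempty; ∣_∣)
open import Data.List using (List; []; _∷_; length; lookup; removeAt; mapMaybe; concatMap; replicate; allFin)
open import Data.List.Relation.Unary.All using (All)
open import Data.List.Relation.Unary.Any using (Any)
open import Data.List.Relation.Binary.Permutation.Propositional using (_↭_)
open import Data.Maybe using (Maybe; just; nothing)
open import Data.Product using (Σ; ∃; ∃₂; _×_; _,_; proj₁; proj₂)
open import Data.Sum using (_⊎_)
open import Relation.Nullary using (¬_; yes; no)
open import Relation.Binary.PropositionalEquality using (_≡_; _≢_)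
open import Relation.Binary.Construct.Closure.ReflexiveTransitive using (Star)
open import Relation.Binary.Construct.Closure.Transitive using (TransClosure)

-- Finite multigraphs: vertex set Fin V, edges a list of (unordered) pairs
-- of endpoints; parallel edges = repeated entries.

record Graph : Set where
  constructor mkGraph
  field
    V : ℕ
    E : List (Fin V × Fin V)
open Graph public

Joins : ∀ {V} → Fin V × Fin V → Fin V → Fin V → Set
Joins e a b = e ≡ (a , b) ⊎ e ≡ (b , a)

Touches : ∀ {V} → Fin V × Fin V → Fin V → Set
Touches e u = proj₁ e ≡ u ⊎ proj₂ e ≡ u

dropVertex : ∀ {V} → Fin (suc V) → List (Fin (suc V) × Fin (suc V)) → List (Fin V × Fin V)
dropVertex {V} v = mapMaybe f
  where
  f : Fin (suc V) × Fin (suc V) → Maybe (Fin V × Fin V)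
  f (a , b) with v ≟ a | v ≟ b
  ... | no v≢a | no v≢b = just (punchOut v≢a , punchOut v≢b)
  ... | _      | _      = nothing

data Step : Graph → Graph → Set where
  delEdge   : ∀ {V} (E : List (Fin V × Fin V)) (i : Fin (length E)) →
              Step (mkGraph V E) (mkGraph V (removeAt E i))
  delVertex : ∀ {V} (E : List (Fin (suc V) × Fin (suc V))) (v : Fin (suc V)) →
              Step (mkGraph (suc V) E) (mkGraph V (dropVertex v E))
  -- u has exactly two incident edges e₁ (to v) and e₂ (to w), v ≠ w;
  -- E' are the remaining edges; replace u, e₁, e₂ by an edge vw.
  smooth    : ∀ {V} (E E' : List (Fin (suc V) × Fin (suc V)))
              (u v w : Fin (suc V)) (e₁ e₂ : Fin (suc V) × Fin (suc V)) →
              v ≢ u → w ≢ u → v ≢ w →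
              Joins e₁ u v → Joins e₂ u w →
              All (λ e → ¬ Touches e u) E' →
              E ↭ (e₁ ∷ e₂ ∷ E') →
              Step (mkGraph (suc V) E) (mkGraph V (dropVertex u ((v , w) ∷ E')))

ProperTopMinor : Graph → Graph → Set
ProperTopMinor G H = TransClosure Step G H

Adj : (G : Graph) → Fin (V G) → Fin (V G) → Set
Adj G a b = Σ (Fin (length (E G))) λ i → Joins (lookup (E G) i) a b

AdjAvoid : (G : Graph) → Subset (length (E G)) → Fin (V G) → Fin (V G) → Set
AdjAvoid G C a b = Σ (Fin (length (E G))) λ i → i ∉ C × Joins (lookup (E G) i) a b

InducedConnected : (G : Graph) → Subset (V G) → Set
InducedConnected G S =
  ∀ {x y} → x ∈ S → y ∈ S → Star (λ a b → a ∈ S × b ∈ S × Adj G a b) x y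

IsEgg : (G : Graph) → Subset (V G) → Set
IsEgg G S = Nonempty S × InducedConnected G S

IsScramble : (G : Graph) → List (Subset (V G)) → Set
IsScramble G 𝒮 = All (IsEgg G) 𝒮

Hits : ∀ {n} → Subset n → List (Subset n) → Set
Hits T 𝒮 = All (λ egg → ∃ λ x → x ∈ T × x ∈ egg) 𝒮

IsEggCut : (G : Graph) → List (Subset (V G)) → Subset (length (E G)) → Set
IsEggCut G 𝒮 C =
  ∃₂ λ E₁ E₂ → Any (E₁ ≡_) 𝒮 × Any (E₂ ≡_) 𝒮 ×
    (∀ {x y} → x ∈ E₁ → y ∈ E₂ → ¬ Star (AdjAvoid G C) x y)

-- ‖𝒮‖ = min(h(𝒮), e(𝒮)) ≥ m, i.e. h(𝒮) ≥ m and e(𝒮) ≥ m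
OrderAtLeast : (G : Graph) → List (Subset (V G)) → ℕ → Set
OrderAtLeast G 𝒮 m =
  (∀ T → Hits T 𝒮 → m ≤ ∣ T ∣) ×
  (∀ C → IsEggCut G 𝒮 C → m ≤ ∣ C ∣)

SnAtLeast : Graph → ℕ → Set
SnAtLeast G m = ∃ λ 𝒮 → IsScramble G 𝒮 × OrderAtLeast G 𝒮 m

ScrambleMinimal : ℕ → Graph → Set
ScrambleMinimal m G =
  SnAtLeast G m × (∀ H → ProperTopMinor G H → ¬ SnAtLeast H m)

-- The graph C̃_{n;k}: vertex j (0-based) is v_{j+1}.

next : ∀ {n} → Fin n → Fin n
next {suc m} j with suc (toℕ j) <? suc m
... | yes p = fromℕ< p
... | no _  = fzero

mult : ℕ → ∀ {n} → Fin n → ℕ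
mult k j with toℕ j <? 2 * k
... | yes _ = suc k
... | no _  = k

Ctilde : ℕ → ℕ → Graph
Ctilde n k = mkGraph n (concatMap (λ j → replicate (mult k j) (j , next j)) (allFin n))

-- Lower bound: the singletons of the first 2k+1 vertices v₁, …, v_{2k+1} form a scramble. A hitting
-- set must contain all of them, and an edge cut separating two of them must contain a whole bundle of
-- parallel edges on each of the two arcs between them; the bundle on the arc inside v₁ … v_{2k+1} is
-- thick (k+1 edges) and the other one has at least k edges.
--
-- Upper bound: the scramble number never increases under deleting edges or vertices or under smoothing,
-- so only the first operation of a proper topological minor matters. No vertex of C̃ has degree 2, and
-- deleting a vertex also deletes one of its edges, so it suffices to delete one edge of the bundle
-- leaving a vertex b. Then sweep across the arcs of the cycle that start right after b. An arc is cut
-- off by the remaining edges at b and the bundle leaving its last vertex; while these are at most 2k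
-- edges, no egg of a scramble of order 2k+1 lies inside the arc while another lies outside. The sweep
-- starts and ends at arcs whose inside, resp. outside, has at most 2k vertices, so at some step an egg
-- appears inside; then every egg meets the vertex just added or the first vertex of the arcs.

module Submission where

open import Defs
open import Data.Bool using (Bool; true; false)
open import Data.Bool.Properties using (¬-not; not-¬)
import Data.Bool.Properties as Boolₚ
open import Data.Empty using (⊥; ⊥-elim)
open import Data.Fin using (Fin; toℕ; fromℕ; fromℕ<; inject₁; inject≤; punchIn)
  renaming (zero to fzero; suc to fsuc)
import Data.Fin.Properties as Finₚ
open import Data.Fin.Subset
  using (Subset; Empty; Nonempty; _∈_; _∉_; _⊆_; ∣_∣; _∪_; _∩_; _-_; ⁅_⁆; ⊤; inside; outside)
open import Data.Fin.Subset.Properties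
open import Data.List
  using (List; []; _∷_; _++_; length; lookup; filter; removeAt; replicate; tabulate; map; concat; allFin)
open import Data.List.Properties
  using (map-tabulate; length-replicate; length-filter; filter-all; filter-none; filter-++; ++-identityʳ)
open import Data.List.Membership.Propositional using (find; lose) renaming (_∈_ to _∈ₗ_)
open import Data.List.Membership.Propositional.Properties using (∈-lookup; ∈-map⁻; ∈-tabulate⁻)
open import Data.List.Relation.Unary.All as All using (All)
import Data.List.Relation.Unary.All.Properties as Allₚ
open import Data.List.Relation.Unary.Any as Any using (Any)
open import Data.List.Relation.Binary.Permutation.Propositional using (_↭_)
import Data.List.Relation.Binary.Permutation.Propositional as ↭
open import Data.List.Relation.Binary.Permutation.Propositional.Properties using (filter-↭; ↭-length)
open import Data.List.Relation.Binary.Sublist.Heterogeneous using (Sublist; []; _∷_; _∷ʳ_)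
import Data.List.Relation.Binary.Sublist.Heterogeneous.Properties as Sublistₚ
open import Data.Nat using (ℕ; zero; suc; _+_; _*_; _∸_; _⊓_; _≤_; _<_; z≤n; s≤s; z<s; _≟_; _≤?_; _<?_)
open import Data.Nat.Properties
import Data.Product as Product
open import Data.Product using (∃; _×_; _,_; proj₁; proj₂)
import Data.Sum as Sum
open import Data.Sum using (_⊎_; inj₁; inj₂; [_,_]′)
import Data.Vec as Vec
open import Data.Vec using (_∷_; []; here; there)
import Data.Vec.Properties as Vecₚ
open import Function using (_∘_; id)
open import Function.Bundles using (mk⇔)
open import Level using (Level)
open import Relation.Binary using (REL)
open import Relation.Binary.Construct.Closure.ReflexiveTransitive using (Star; ε; _◅_)
import Relation.Binary.Construct.Closure.ReflexiveTransitive as Star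
open import Relation.Binary.Construct.Closure.Transitive using ([_]; _∷_)
open import Relation.Binary.Definitions using (tri<; tri≈; tri>)
open import Relation.Binary.PropositionalEquality
open import Relation.Nullary using (¬_; Dec; yes; no; does; _×-dec_; _⊎-dec_; _→-dec_)
open import Relation.Nullary.Decidable using (dec-true; does-⇔; decidable-stable)
import Relation.Nullary.Decidable as Dec
open import Relation.Unary using (Pred; Decidable)

private
  variable
    ℓ ℓ′ r : Level
    A A′ : Set ℓ′
    m n : ℕ
    G H : Graph

does≡true⇒ : ∀ {A : Set ℓ} (a? : Dec A) → does a? ≡ true → A
does≡true⇒ (yes a) _ = a

does≡false⇒ : ∀ {A : Set ℓ} (a? : Dec A) → does a? ≡ false → ¬ A
does≡false⇒ (no ¬a) _ = ¬a

setOf : {P : Pred (Fin n) ℓ} → Decidable P → Subset n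
setOf P? = Vec.tabulate (does ∘ P?)

module _ {P : Pred (Fin n) ℓ} (P? : Decidable P) where

  ∈-setOf⁺ : ∀ {x} → P x → x ∈ setOf P?
  ∈-setOf⁺ {x} px = Vecₚ.lookup⇒[]= x (setOf P?) (trans (Vecₚ.lookup∘tabulate _ x) (dec-true (P? x) px))

  ∈-setOf⁻ : ∀ {x} → x ∈ setOf P? → P x
  ∈-setOf⁻ {x} x∈ = does≡true⇒ (P? x) (trans (sym (Vecₚ.lookup∘tabulate (does ∘ P?) x)) (Vecₚ.[]=⇒lookup x∈))

_⁻¹_ : (Fin m → Fin n) → Subset n → Subset m
f ⁻¹ q = setOf (λ x → f x ∈? q)

∈-⁻¹⁺ : ∀ (f : Fin m → Fin n) {q x} → f x ∈ q → x ∈ f ⁻¹ q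
∈-⁻¹⁺ f {q} = ∈-setOf⁺ (λ x → f x ∈? q)

∈-⁻¹⁻ : ∀ (f : Fin m → Fin n) {q x} → x ∈ f ⁻¹ q → f x ∈ q
∈-⁻¹⁻ f {q} = ∈-setOf⁻ (λ x → f x ∈? q)

image : (Fin m → Fin n) → Subset m → Subset n
image f p = setOf (λ x → Finₚ.any? (λ y → y ∈? p ×-dec f y Finₚ.≟ x))

∈-image⁺ : ∀ (f : Fin m → Fin n) {p y} → y ∈ p → f y ∈ image f p
∈-image⁺ f {p} {y} y∈ = ∈-setOf⁺ (λ x → Finₚ.any? (λ y → y ∈? p ×-dec f y Finₚ.≟ x)) (y , y∈ , refl)

∈-image⁻ : ∀ (f : Fin m → Fin n) {p x} → x ∈ image f p → ∃ λ y → y ∈ p × f y ≡ x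
∈-image⁻ f {p} = ∈-setOf⁻ (λ x → Finₚ.any? (λ y → y ∈? p ×-dec f y Finₚ.≟ x))

∣p∪q∣+∣p∩q∣≡∣p∣+∣q∣ : ∀ (p q : Subset n) → ∣ p ∪ q ∣ + ∣ p ∩ q ∣ ≡ ∣ p ∣ + ∣ q ∣
∣p∪q∣+∣p∩q∣≡∣p∣+∣q∣ []            []            = refl
∣p∪q∣+∣p∩q∣≡∣p∣+∣q∣ (outside ∷ p) (outside ∷ q) = ∣p∪q∣+∣p∩q∣≡∣p∣+∣q∣ p q
∣p∪q∣+∣p∩q∣≡∣p∣+∣q∣ (outside ∷ p) (inside ∷ q)  =
  trans (cong suc (∣p∪q∣+∣p∩q∣≡∣p∣+∣q∣ p q)) (sym (+-suc ∣ p ∣ ∣ q ∣))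
∣p∪q∣+∣p∩q∣≡∣p∣+∣q∣ (inside ∷ p)  (outside ∷ q) = cong suc (∣p∪q∣+∣p∩q∣≡∣p∣+∣q∣ p q)
∣p∪q∣+∣p∩q∣≡∣p∣+∣q∣ (inside ∷ p)  (inside ∷ q)  = cong suc (begin
  ∣ p ∪ q ∣ + suc ∣ p ∩ q ∣   ≡⟨ +-suc ∣ p ∪ q ∣ ∣ p ∩ q ∣ ⟩
  suc (∣ p ∪ q ∣ + ∣ p ∩ q ∣) ≡⟨ cong suc (∣p∪q∣+∣p∩q∣≡∣p∣+∣q∣ p q) ⟩
  suc (∣ p ∣ + ∣ q ∣)         ≡⟨ +-suc ∣ p ∣ ∣ q ∣ ⟨
  ∣ p ∣ + suc ∣ q ∣           ∎)
  where open ≡-Reasoning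

∣p∪q∣≤∣p∣+∣q∣ : ∀ (p q : Subset n) → ∣ p ∪ q ∣ ≤ ∣ p ∣ + ∣ q ∣
∣p∪q∣≤∣p∣+∣q∣ p q = subst (∣ p ∪ q ∣ ≤_) (∣p∪q∣+∣p∩q∣≡∣p∣+∣q∣ p q) (m≤m+n ∣ p ∪ q ∣ ∣ p ∩ q ∣)

disjoint⇒∣p∪q∣≡∣p∣+∣q∣ : ∀ (p q : Subset n) → Empty (p ∩ q) → ∣ p ∪ q ∣ ≡ ∣ p ∣ + ∣ q ∣
disjoint⇒∣p∪q∣≡∣p∣+∣q∣ {n} p q p∩q≡∅ = begin
  ∣ p ∪ q ∣             ≡⟨ +-identityʳ ∣ p ∪ q ∣ ⟨
  ∣ p ∪ q ∣ + 0         ≡⟨ cong (∣ p ∪ q ∣ +_) (trans (cong ∣_∣ (Empty-unique p∩q≡∅)) (∣⊥∣≡0 n)) ⟨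
  ∣ p ∪ q ∣ + ∣ p ∩ q ∣ ≡⟨ ∣p∪q∣+∣p∩q∣≡∣p∣+∣q∣ p q ⟩
  ∣ p ∣ + ∣ q ∣         ∎
  where open ≡-Reasoning

0<∣p∣⇒nonempty : ∀ (p : Subset n) → 0 < ∣ p ∣ → Nonempty p
0<∣p∣⇒nonempty {n} p 0<∣p∣ with nonempty? p
... | yes p≢∅ = p≢∅
... | no  p≡∅ = ⊥-elim (<⇒≢ 0<∣p∣ (sym (trans (cong ∣_∣ (Empty-unique p≡∅)) (∣⊥∣≡0 n))))

InjectiveOn : Subset m → (Fin m → Fin n) → Set
InjectiveOn p f = ∀ {x y} → x ∈ p → y ∈ p → f x ≡ f y → x ≡ y

injectiveOn⇒∣p∣≤∣q∣ : ∀ {p : Subset m} {q : Subset n} (f : Fin m → Fin n) →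
  InjectiveOn p f → (∀ {x} → x ∈ p → f x ∈ q) → ∣ p ∣ ≤ ∣ q ∣
injectiveOn⇒∣p∣≤∣q∣ {p = []} f _ _ = z≤n
injectiveOn⇒∣p∣≤∣q∣ {p = outside ∷ p} f injective maps =
  injectiveOn⇒∣p∣≤∣q∣ (f ∘ fsuc) (λ x∈ y∈ → Finₚ.suc-injective ∘ injective (there x∈) (there y∈)) (maps ∘ there)
injectiveOn⇒∣p∣≤∣q∣ {p = inside ∷ p} {q} f injective maps =
  <-≤-trans (s≤s (injectiveOn⇒∣p∣≤∣q∣ (f ∘ fsuc) injective′ maps′)) (x∈p⇒∣p-x∣<∣p∣ (maps here))
  where
  injective′ : InjectiveOn p (f ∘ fsuc)
  injective′ x∈ y∈ = Finₚ.suc-injective ∘ injective (there x∈) (there y∈)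
  maps′ : ∀ {x} → x ∈ p → f (fsuc x) ∈ q - f fzero
  maps′ x∈ = x∈p∧x≢y⇒x∈p-y (maps (there x∈)) (λ eq → Finₚ.0≢1+n (injective here (there x∈) (sym eq)))

∣f⁻¹q∣≤∣q∣ : ∀ {f : Fin m → Fin n} {q} → (∀ {x y} → f x ≡ f y → x ≡ y) → ∣ f ⁻¹ q ∣ ≤ ∣ q ∣
∣f⁻¹q∣≤∣q∣ {f = f} injective = injectiveOn⇒∣p∣≤∣q∣ f (λ _ _ → injective) (∈-⁻¹⁻ f)

injectiveLabels⇒∣p∣≤ : ∀ {p : Subset n} (f : Fin n → ℕ) {c} →
  (∀ {x y} → x ∈ p → y ∈ p → f x ≡ f y → x ≡ y) → (∀ {x} → x ∈ p → f x < c) → ∣ p ∣ ≤ c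
injectiveLabels⇒∣p∣≤ {n} f {zero} _ bounded =
  ≤-reflexive (trans (cong ∣_∣ (Empty-unique λ (x , x∈) → n≮0 (bounded x∈))) (∣⊥∣≡0 n))
injectiveLabels⇒∣p∣≤ {p = p} f {suc c} injective bounded = begin
  ∣ p ∣             ≤⟨ injectiveOn⇒∣p∣≤∣q∣ {q = ⊤} label label-injective (λ _ → ∈⊤) ⟩
  ∣ ⊤ {n = suc c} ∣ ≡⟨ ∣⊤∣≡n (suc c) ⟩
  suc c             ∎
  where
  open ≤-Reasoning
  label : Fin _ → Fin (suc c)
  label x = fromℕ< (s≤s (m⊓n≤n (f x) c))
  toℕ-label : ∀ {x} → x ∈ p → toℕ (label x) ≡ f x
  toℕ-label x∈ = trans (Finₚ.toℕ-fromℕ< _) (m≤n⇒m⊓n≡m (≤-pred (bounded x∈)))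
  label-injective : InjectiveOn p label
  label-injective x∈ y∈ eq = injective x∈ y∈ (trans (sym (toℕ-label x∈)) (trans (cong toℕ eq) (toℕ-label y∈)))

redirect : (Fin m → Fin n) → Fin n → Fin n → Subset n → Fin m → Fin n
redirect g s t X y with t ∈? X | g y Finₚ.≟ s
... | yes _ | yes _ = t
... | _     | _     = g y

redirect-injective : ∀ {g : Fin m → Fin n} s t X → (∀ {x y} → g x ≡ g y → x ≡ y) → (∀ y → g y ≢ t) →
  ∀ {x y} → redirect g s t X x ≡ redirect g s t X y → x ≡ y
redirect-injective {g = g} s t X g-injective g≢t {x} {y} eq with t ∈? X | g x Finₚ.≟ s | g y Finₚ.≟ s
... | yes _ | yes gx≡s | yes gy≡s = g-injective (trans gx≡s (sym gy≡s))
... | yes _ | yes _    | no _     = ⊥-elim (g≢t y (sym eq))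
... | yes _ | no _     | yes _    = ⊥-elim (g≢t x eq)
... | yes _ | no _     | no _     = g-injective eq
... | no _  | _        | _        = g-injective eq

∈-redirect : ∀ (g : Fin m → Fin n) s t {X} y → g y ∈ X ⊎ (g y ≡ s × t ∈ X) → redirect g s t X y ∈ X
∈-redirect g s t {X} y gy∈ with t ∈? X | g y Finₚ.≟ s
∈-redirect g s t y (inj₁ gy∈)        | yes t∈ | yes _   = t∈
∈-redirect g s t y (inj₁ gy∈)        | yes _  | no _    = gy∈
∈-redirect g s t y (inj₁ gy∈)        | no _   | _       = gy∈
∈-redirect g s t y (inj₂ (_ , t∈))   | yes _  | yes _   = t∈
∈-redirect g s t y (inj₂ (gy≡s , _)) | yes _  | no gy≢s = ⊥-elim (gy≢s gy≡s)
∈-redirect g s t y (inj₂ (_ , t∈))   | no t∉  | _       = ⊥-elim (t∉ t∈)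

∣setOf-lookup∣≡length-filter : {P : Pred A ℓ} (P? : Decidable P) (xs : List A) →
  ∣ setOf (P? ∘ lookup xs) ∣ ≡ length (filter P? xs)
∣setOf-lookup∣≡length-filter P? []       = refl
∣setOf-lookup∣≡length-filter P? (x ∷ xs) with P? x
... | yes _ = cong suc (∣setOf-lookup∣≡length-filter P? xs)
... | no _  = ∣setOf-lookup∣≡length-filter P? xs

record Embedding (R : REL A A′ r) (xs : List A) (ys : List A′) : Set r where
  field
    index           : Fin (length xs) → Fin (length ys)
    index-injective : ∀ {i j} → index i ≡ index j → i ≡ j
    lookup-index    : ∀ i → R (lookup xs i) (lookup ys (index i))
open Embedding public

module _ {R : REL A A′ r} where

  Embedding-skip : ∀ {xs ys y} → Embedding R xs ys → Embedding R xs (y ∷ ys)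
  Embedding-skip π = record
    { index           = fsuc ∘ index π
    ; index-injective = index-injective π ∘ Finₚ.suc-injective
    ; lookup-index    = lookup-index π
    }

  Embedding-keep : ∀ {x y xs ys} → R x y → Embedding R xs ys → Embedding R (x ∷ xs) (y ∷ ys)
  Embedding-keep {x} {y} {xs} {ys} rxy π =
    record { index = shift ; index-injective = injective ; lookup-index = look }
    where
    shift : Fin (suc (length xs)) → Fin (suc (length ys))
    shift fzero    = fzero
    shift (fsuc i) = fsuc (index π i)
    injective : ∀ {i j} → shift i ≡ shift j → i ≡ j
    injective {fzero}  {fzero}  _  = refl
    injective {fsuc i} {fsuc j} eq = cong fsuc (index-injective π (Finₚ.suc-injective eq))
    look : ∀ i → R (lookup (x ∷ xs) i) (lookup (y ∷ ys) (shift i))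
    look fzero    = rxy
    look (fsuc i) = lookup-index π i

  Sublist⇒Embedding : ∀ {xs ys} → Sublist R xs ys → Embedding R xs ys
  Sublist⇒Embedding []        = record { index = λ () ; index-injective = λ {} ; lookup-index = λ () }
  Sublist⇒Embedding (y ∷ʳ σ)  = Embedding-skip (Sublist⇒Embedding σ)
  Sublist⇒Embedding (rxy ∷ σ) = Embedding-keep rxy (Sublist⇒Embedding σ)

module _ {A : Set ℓ} where

  Embedding-refl : ∀ {xs : List A} → Embedding _≡_ xs xs
  Embedding-refl = record { index = id ; index-injective = id ; lookup-index = λ _ → refl }

  Embedding-trans : ∀ {xs ys zs : List A} → Embedding _≡_ xs ys → Embedding _≡_ ys zs → Embedding _≡_ xs zs
  Embedding-trans π π′ = record
    { index           = index π′ ∘ index π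
    ; index-injective = index-injective π ∘ index-injective π′
    ; lookup-index    = λ i → trans (lookup-index π i) (lookup-index π′ (index π i))
    }

  Embedding-swap : ∀ {x y : A} {xs ys} → Embedding _≡_ xs ys → Embedding _≡_ (x ∷ y ∷ xs) (y ∷ x ∷ ys)
  Embedding-swap {x} {y} {xs} {ys} π =
    record { index = twist ; index-injective = injective ; lookup-index = look }
    where
    twist : Fin (suc (suc (length xs))) → Fin (suc (suc (length ys)))
    twist fzero           = fsuc fzero
    twist (fsuc fzero)    = fzero
    twist (fsuc (fsuc i)) = fsuc (fsuc (index π i))
    injective : ∀ {i j} → twist i ≡ twist j → i ≡ j
    injective {fzero}         {fzero}         _  = refl
    injective {fsuc fzero}    {fsuc fzero}    _  = refl
    injective {fsuc (fsuc i)} {fsuc (fsuc j)} eq =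
      cong (fsuc ∘ fsuc) (index-injective π (Finₚ.suc-injective (Finₚ.suc-injective eq)))
    injective {fzero}         {fsuc (fsuc _)} ()
    injective {fsuc fzero}    {fsuc (fsuc _)} ()
    injective {fsuc (fsuc _)} {fzero}         ()
    injective {fsuc (fsuc _)} {fsuc fzero}    ()
    look : ∀ i → lookup (x ∷ y ∷ xs) i ≡ lookup (y ∷ x ∷ ys) (twist i)
    look fzero           = refl
    look (fsuc fzero)    = refl
    look (fsuc (fsuc i)) = lookup-index π i

  ↭⇒Embedding : ∀ {xs ys : List A} → xs ↭ ys → Embedding _≡_ ys xs
  ↭⇒Embedding ↭.refl         = Embedding-refl
  ↭⇒Embedding (↭.prep x p)   = Embedding-keep refl (↭⇒Embedding p)
  ↭⇒Embedding (↭.swap x y p) = Embedding-swap (↭⇒Embedding p)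
  ↭⇒Embedding (↭.trans p q)  = Embedding-trans (↭⇒Embedding q) (↭⇒Embedding p)

removeAt-Sublist : ∀ (xs : List A) i → Sublist _≡_ (removeAt xs i) xs
removeAt-Sublist (x ∷ xs) fzero    = x ∷ʳ Sublistₚ.refl refl
removeAt-Sublist (x ∷ xs) (fsuc i) = refl ∷ removeAt-Sublist xs i

module _ {P : Pred A ℓ} (P? : Decidable P) where

  length-filter-removeAt : ∀ (xs : List A) i → P (lookup xs i) →
    suc (length (filter P? (removeAt xs i))) ≡ length (filter P? xs)
  length-filter-removeAt (x ∷ xs) fzero    px with P? x
  ... | yes _  = refl
  ... | no ¬px = ⊥-elim (¬px px)
  length-filter-removeAt (x ∷ xs) (fsuc i) px with P? x
  ... | yes _ = cong suc (length-filter-removeAt xs i px)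
  ... | no _  = length-filter-removeAt xs i px

  length-filter-pair : ∀ x y {zs} → All (¬_ ∘ P) zs → length (filter P? (x ∷ y ∷ zs)) ≤ 2
  length-filter-pair x y {zs} none = begin
    length (filter P? (x ∷ y ∷ zs))                ≡⟨ cong length (filter-++ P? (x ∷ y ∷ []) zs) ⟩
    length (filter P? (x ∷ y ∷ []) ++ filter P? zs) ≡⟨ cong (length ∘ (filter P? (x ∷ y ∷ []) ++_)) (filter-none P? none) ⟩
    length (filter P? (x ∷ y ∷ []) ++ [])           ≡⟨ cong length (++-identityʳ (filter P? (x ∷ y ∷ []))) ⟩
    length (filter P? (x ∷ y ∷ []))                ≤⟨ length-filter P? (x ∷ y ∷ []) ⟩
    2                                              ∎
    where open ≤-Reasoning

  filter-concat-none : ∀ {n} (F : Fin n → List A) → (∀ j → filter P? (F j) ≡ []) →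
    filter P? (concat (tabulate F)) ≡ []
  filter-concat-none {zero}  F none = refl
  filter-concat-none {suc n} F none = begin
    filter P? (F fzero ++ rest)           ≡⟨ filter-++ P? (F fzero) rest ⟩
    filter P? (F fzero) ++ filter P? rest ≡⟨ cong₂ _++_ (none fzero) (filter-concat-none (F ∘ fsuc) (none ∘ fsuc)) ⟩
    []                                    ∎
    where
    open ≡-Reasoning
    rest : List A
    rest = concat (tabulate (F ∘ fsuc))

  filter-concat-single : ∀ {n} (F : Fin n → List A) a → (∀ j → j ≢ a → filter P? (F j) ≡ []) →
    filter P? (concat (tabulate F)) ≡ filter P? (F a)
  filter-concat-single {suc n} F fzero others = begin
    filter P? (F fzero ++ rest)           ≡⟨ filter-++ P? (F fzero) rest ⟩
    filter P? (F fzero) ++ filter P? rest ≡⟨ cong (filter P? (F fzero) ++_) (filter-concat-none (F ∘ fsuc) later) ⟩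
    filter P? (F fzero) ++ []             ≡⟨ ++-identityʳ (filter P? (F fzero)) ⟩
    filter P? (F fzero)                   ∎
    where
    open ≡-Reasoning
    rest : List A
    rest = concat (tabulate (F ∘ fsuc))
    later : ∀ j → filter P? (F (fsuc j)) ≡ []
    later j = others (fsuc j) λ ()
  filter-concat-single {suc n} F (fsuc a) others = begin
    filter P? (F fzero ++ rest)           ≡⟨ filter-++ P? (F fzero) rest ⟩
    filter P? (F fzero) ++ filter P? rest ≡⟨ cong (_++ filter P? rest) (others fzero λ ()) ⟩
    filter P? rest                        ≡⟨ filter-concat-single (F ∘ fsuc) a later ⟩
    filter P? (F (fsuc a))                ∎
    where
    open ≡-Reasoning
    rest : List A
    rest = concat (tabulate (F ∘ fsuc))
    later : ∀ j → j ≢ a → filter P? (F (fsuc j)) ≡ []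
    later j j≢a = others (fsuc j) (j≢a ∘ Finₚ.suc-injective)

Joins-sym : ∀ {e : Fin n × Fin n} {a b} → Joins e a b → Joins e b a
Joins-sym (inj₁ eq) = inj₂ eq
Joins-sym (inj₂ eq) = inj₁ eq

Joins-map : ∀ (f : Fin m → Fin n) {e a b} → Joins e a b → Joins (Product.map f f e) (f a) (f b)
Joins-map f (inj₁ refl) = inj₁ refl
Joins-map f (inj₂ refl) = inj₂ refl

Joins-pair : ∀ {a c x y : Fin n} → Joins (a , c) x y → (x ≡ a × y ≡ c) ⊎ (x ≡ c × y ≡ a)
Joins-pair (inj₁ refl) = inj₁ (refl , refl)
Joins-pair (inj₂ refl) = inj₂ (refl , refl)

touches? : ∀ (e : Fin n × Fin n) u → Dec (Touches e u)
touches? e u = (proj₁ e Finₚ.≟ u) ⊎-dec (proj₂ e Finₚ.≟ u)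

AdjAvoid-sym : ∀ {C a b} → AdjAvoid G C a b → AdjAvoid G C b a
AdjAvoid-sym (j , j∉ , joins) = j , j∉ , Joins-sym joins

singleton-isEgg : ∀ (x : Fin (V G)) → IsEgg G ⁅ x ⁆
singleton-isEgg x = (x , x∈⁅x⁆ x) , λ a∈ b∈ → subst₂ (Star _) (sym (x∈⁅y⁆⇒x≡y x a∈)) (sym (x∈⁅y⁆⇒x≡y x b∈)) ε

EdgeImage : (Fin m → Fin n) → Fin m × Fin m → Fin n × Fin n → Set
EdgeImage f e e′ = Product.map f f e ≡ e′

dropVertex-Sublist : ∀ (v : Fin (suc n)) es → Sublist (EdgeImage (punchIn v)) (dropVertex v es) es
dropVertex-Sublist v [] = []
dropVertex-Sublist v ((a , b) ∷ es) with v Finₚ.≟ a | v Finₚ.≟ b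
... | no v≢a | no v≢b = cong₂ _,_ (Finₚ.punchIn-punchOut v≢a) (Finₚ.punchIn-punchOut v≢b) ∷ dropVertex-Sublist v es
... | yes _  | _      = _ ∷ʳ dropVertex-Sublist v es
... | no _   | yes _  = _ ∷ʳ dropVertex-Sublist v es

dropVertex-removeAt : ∀ (v : Fin (suc n)) es i → Touches (lookup es i) v →
  dropVertex v (removeAt es i) ≡ dropVertex v es
dropVertex-removeAt v ((a , b) ∷ es) fzero touches with v Finₚ.≟ a | v Finₚ.≟ b
... | yes _  | _      = refl
... | no _   | yes _  = refl
... | no v≢a | no v≢b = ⊥-elim ([ v≢a ∘ sym , v≢b ∘ sym ]′ touches)
dropVertex-removeAt v ((a , b) ∷ es) (fsuc i) touches with v Finₚ.≟ a | v Finₚ.≟ b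
... | yes _  | _      = dropVertex-removeAt v es i touches
... | no _   | yes _  = dropVertex-removeAt v es i touches
... | no _   | no _   = cong (_ ∷_) (dropVertex-removeAt v es i touches)

-- Monotonicity of the scramble number under topological minors

record Simulation (G H : Graph) : Set where
  field
    vertex       : Fin (V H) → Fin (V G)
    egg          : Subset (V H) → Subset (V G)
    egg-isEgg    : ∀ {Z} → IsEgg H Z → IsEgg G (egg Z)
    vertex-∈-egg : ∀ {Z x} → x ∈ Z → vertex x ∈ egg Z
    hitter       : Subset (V G) → Subset (V H)
    ∣hitter∣≤    : ∀ T → ∣ hitter T ∣ ≤ ∣ T ∣
    hitter-hits  : ∀ {T Z x} → x ∈ T → x ∈ egg Z → ∃ λ y → y ∈ hitter T × y ∈ Z
    cut          : Subset (length (E G)) → Subset (length (E H))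
    ∣cut∣≤       : ∀ C → ∣ cut C ∣ ≤ ∣ C ∣
    cut-path     : ∀ C {a b} → AdjAvoid H (cut C) a b → Star (AdjAvoid G C) (vertex a) (vertex b)

sn-simulation : Simulation G H → SnAtLeast H m → SnAtLeast G m
sn-simulation {G} {H} {m} sim (𝒮 , eggs , hits≥ , cuts≥) =
  map egg 𝒮 , Allₚ.map⁺ (All.map egg-isEgg eggs) , hits≥′ , cuts≥′
  where
  open Simulation sim
  hits≥′ : ∀ T → Hits T (map egg 𝒮) → m ≤ ∣ T ∣
  hits≥′ T hits =
    ≤-trans (hits≥ (hitter T) (All.map (λ (_ , x∈T , x∈Z) → hitter-hits x∈T x∈Z) (Allₚ.map⁻ hits))) (∣hitter∣≤ T)
  cuts≥′ : ∀ C → IsEggCut G (map egg 𝒮) C → m ≤ ∣ C ∣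
  cuts≥′ C (_ , _ , Z₁∈ , Z₂∈ , separated) with ∈-map⁻ egg Z₁∈ | ∈-map⁻ egg Z₂∈
  ... | Z₁ , Z₁∈𝒮 , refl | Z₂ , Z₂∈𝒮 , refl = ≤-trans (cuts≥ (cut C) (Z₁ , Z₂ , Z₁∈𝒮 , Z₂∈𝒮 , separated′)) (∣cut∣≤ C)
    where
    separated′ : ∀ {x y} → x ∈ Z₁ → y ∈ Z₂ → ¬ Star (AdjAvoid H (cut C)) x y
    separated′ x∈ y∈ = separated (vertex-∈-egg x∈) (vertex-∈-egg y∈) ∘ Star.kleisliStar vertex (cut-path C)

subgraph-simulation : (f : Fin (V H) → Fin (V G)) → (∀ {x y} → f x ≡ f y → x ≡ y) →
  Embedding (EdgeImage f) (E H) (E G) → Simulation G H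
subgraph-simulation {H = H} {G = G} f f-injective π = record
  { vertex       = f
  ; egg          = image f
  ; egg-isEgg    = λ ((x , x∈) , connected) → (f x , ∈-image⁺ f x∈) , connected↑ connected
  ; vertex-∈-egg = ∈-image⁺ f
  ; hitter       = f ⁻¹_
  ; ∣hitter∣≤    = λ T → ∣f⁻¹q∣≤∣q∣ f-injective
  ; hitter-hits  = hits
  ; cut          = index π ⁻¹_
  ; ∣cut∣≤       = λ C → ∣f⁻¹q∣≤∣q∣ (index-injective π)
  ; cut-path     = λ C (j , j∉ , joins) → (index π j , j∉ ∘ ∈-⁻¹⁺ (index π) , joins↑ j joins) ◅ ε
  }
  where
  joins↑ : ∀ j {a b} → Joins (lookup (E H) j) a b → Joins (lookup (E G) (index π j)) (f a) (f b)
  joins↑ j joins = subst (λ e → Joins e _ _) (lookup-index π j) (Joins-map f joins)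
  connected↑ : ∀ {Z} → InducedConnected H Z → InducedConnected G (image f Z)
  connected↑ {Z} connected x∈ y∈ with ∈-image⁻ f x∈ | ∈-image⁻ f y∈
  ... | x , x∈Z , refl | y , y∈Z , refl =
    Star.gmap f (λ (a∈ , b∈ , j , joins) → ∈-image⁺ f a∈ , ∈-image⁺ f b∈ , index π j , joins↑ j joins)
      (connected x∈Z y∈Z)
  hits : ∀ {T Z x} → x ∈ T → x ∈ image f Z → ∃ λ y → y ∈ f ⁻¹ T × y ∈ Z
  hits x∈T x∈Z↑ with ∈-image⁻ f x∈Z↑
  ... | y , y∈Z , refl = y , ∈-⁻¹⁺ f x∈T , y∈Z

sn-deleteEdge : ∀ es i → SnAtLeast (mkGraph n (removeAt es i)) m → SnAtLeast (mkGraph n es) m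
sn-deleteEdge es i = sn-simulation (subgraph-simulation id id (Sublist⇒Embedding (removeAt-Sublist es i)))

sn-deleteVertex : ∀ es v → SnAtLeast (mkGraph n (dropVertex v es)) m → SnAtLeast (mkGraph (suc n) es) m
sn-deleteVertex es v = sn-simulation
  (subgraph-simulation (punchIn v) (Finₚ.punchIn-injective v _ _) (Sublist⇒Embedding (dropVertex-Sublist v es)))

sn-reorder : ∀ {es es′} → es ↭ es′ → SnAtLeast (mkGraph n es′) m → SnAtLeast (mkGraph n es) m
sn-reorder es↭ = sn-simulation (subgraph-simulation id id (↭⇒Embedding es↭))

-- An egg of H₀ containing both ends of the new edge vw also gets u; a hitting set of G₀ that uses u,
-- or a cut that uses e₁, is redirected to v, or to e₂.
module Smoothing {n : ℕ} (es : List (Fin (suc n) × Fin (suc n))) {u v w : Fin (suc n)}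
                 {e₁ e₂ : Fin (suc n) × Fin (suc n)} (e₁-uv : Joins e₁ u v) (e₂-uw : Joins e₂ u w) where

  G₀ : Graph
  G₀ = mkGraph (suc n) (e₁ ∷ e₂ ∷ es)

  H₀ : Graph
  H₀ = mkGraph n (dropVertex u ((v , w) ∷ es))

  private
    σ : Embedding (EdgeImage (punchIn u)) (E H₀) ((v , w) ∷ es)
    σ = Sublist⇒Embedding (dropVertex-Sublist u ((v , w) ∷ es))

    lift : Fin n → Fin (suc n)
    lift = punchIn u

    joins↑ : ∀ j {a b} → Joins (lookup (E H₀) j) a b → Joins (lookup ((v , w) ∷ es) (index σ j)) (lift a) (lift b)
    joins↑ j joins = subst (λ e → Joins e _ _) (lookup-index σ j) (Joins-map lift joins)

    through-u : ∀ {R : Fin (suc n) → Fin (suc n) → Set} → (∀ {x y} → R x y → R y x) → R v u → R u w →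
      ∀ {a b} → Joins (v , w) a b → Star R a b
    through-u sym vu uw (inj₁ refl) = vu ◅ uw ◅ ε
    through-u sym vu uw (inj₂ refl) = Star.reverse sym (vu ◅ uw ◅ ε)

    Joins-ends : ∀ {X : Subset (suc n)} {a b} → Joins (v , w) a b → a ∈ X → b ∈ X → v ∈ X × w ∈ X
    Joins-ends (inj₁ refl) a∈ b∈ = a∈ , b∈
    Joins-ends (inj₂ refl) a∈ b∈ = b∈ , a∈

    member? : ∀ Z x → Dec (x ∈ image lift Z ⊎ (x ≡ u × v ∈ image lift Z × w ∈ image lift Z))
    member? Z x = x ∈? image lift Z ⊎-dec (x Finₚ.≟ u ×-dec (v ∈? image lift Z ×-dec w ∈? image lift Z))

    egg : Subset n → Subset (suc n)
    egg Z = setOf (member? Z)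

    lift-∈-egg : ∀ {Z x} → x ∈ Z → lift x ∈ egg Z
    lift-∈-egg {Z} x∈ = ∈-setOf⁺ (member? Z) (inj₁ (∈-image⁺ lift x∈))

    Within : Subset n → Fin (suc n) → Fin (suc n) → Set
    Within Z a b = a ∈ egg Z × b ∈ egg Z × Adj G₀ a b

    Within-sym : ∀ {Z a b} → Within Z a b → Within Z b a
    Within-sym (a∈ , b∈ , j , joins) = b∈ , a∈ , j , Joins-sym joins

    anchor : ∀ {Z x} → x ∈ egg Z → ∃ λ y → y ∈ Z × Star (Within Z) x (lift y)
    anchor {Z} x∈ with ∈-setOf⁻ (member? Z) x∈
    ... | inj₁ x∈Z↑ with ∈-image⁻ lift x∈Z↑
    ...   | y , y∈Z , refl = y , y∈Z , ε
    anchor {Z} x∈ | inj₂ (refl , v∈Z↑ , _) with ∈-image⁻ lift v∈Z↑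
    ...   | y , y∈Z , refl = y , y∈Z , (x∈ , lift-∈-egg y∈Z , fzero , e₁-uv) ◅ ε

    route-within : ∀ {Z} s {a b} → Joins (lookup ((v , w) ∷ es) s) (lift a) (lift b) → a ∈ Z → b ∈ Z →
      Star (Within Z) (lift a) (lift b)
    route-within {Z} fzero joins a∈ b∈ =
      through-u Within-sym (v∈ , u∈ , fzero , Joins-sym e₁-uv) (u∈ , w∈ , fsuc fzero , e₂-uw) joins
      where
      ends : v ∈ image lift Z × w ∈ image lift Z
      ends = Joins-ends joins (∈-image⁺ lift a∈) (∈-image⁺ lift b∈)
      v∈ : v ∈ egg Z
      v∈ = ∈-setOf⁺ (member? Z) (inj₁ (proj₁ ends))
      w∈ : w ∈ egg Z
      w∈ = ∈-setOf⁺ (member? Z) (inj₁ (proj₂ ends))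
      u∈ : u ∈ egg Z
      u∈ = ∈-setOf⁺ (member? Z) (inj₂ (refl , ends))
    route-within (fsuc t) joins a∈ b∈ = (lift-∈-egg a∈ , lift-∈-egg b∈ , fsuc (fsuc t) , joins) ◅ ε

    egg-isEgg : ∀ {Z} → IsEgg H₀ Z → IsEgg G₀ (egg Z)
    egg-isEgg {Z} ((x , x∈) , connected) = (lift x , lift-∈-egg x∈) , connected↑
      where
      connected↑ : InducedConnected G₀ (egg Z)
      connected↑ x∈ y∈ with anchor x∈ | anchor y∈
      ... | x′ , x′∈ , x↝ | y′ , y′∈ , y↝ =
        x↝ Star.◅◅
        Star.kleisliStar lift (λ (a∈ , b∈ , j , joins) → route-within (index σ j) (joins↑ j joins) a∈ b∈)
          (connected x′∈ y′∈) Star.◅◅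
        Star.reverse Within-sym y↝

    hitter : Subset (suc n) → Subset n
    hitter T = redirect lift v u T ⁻¹ T

    hitter-hits : ∀ {T Z x} → x ∈ T → x ∈ egg Z → ∃ λ y → y ∈ hitter T × y ∈ Z
    hitter-hits {T} {Z} x∈T x∈ with ∈-setOf⁻ (member? Z) x∈
    ... | inj₁ x∈Z↑ with ∈-image⁻ lift x∈Z↑
    ...   | y , y∈Z , refl = y , ∈-⁻¹⁺ (redirect lift v u T) (∈-redirect lift v u y (inj₁ x∈T)) , y∈Z
    hitter-hits {T} {Z} x∈T x∈ | inj₂ (refl , v∈Z↑ , _) with ∈-image⁻ lift v∈Z↑
    ...   | y , y∈Z , lift-y≡v =
      y , ∈-⁻¹⁺ (redirect lift v u T) (∈-redirect lift v u y (inj₂ (lift-y≡v , x∈T))) , y∈Z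

    edge-lift : Fin (length (E H₀)) → Fin (length (E G₀))
    edge-lift j = fsuc (index σ j)

    cut : Subset (length (E G₀)) → Subset (length (E H₀))
    cut C = redirect edge-lift (fsuc fzero) fzero C ⁻¹ C

    route-avoiding : ∀ {C} s {a b} → Joins (lookup ((v , w) ∷ es) s) a b →
      fsuc s ∉ C → (fsuc s ≡ fsuc fzero → fzero ∉ C) → Star (AdjAvoid G₀ C) a b
    route-avoiding fzero    joins 1∉ 0∉ =
      through-u AdjAvoid-sym (fzero , 0∉ refl , Joins-sym e₁-uv) (fsuc fzero , 1∉ , e₂-uw) joins
    route-avoiding (fsuc t) joins s∉ _  = (fsuc (fsuc t) , s∉ , joins) ◅ ε

    cut-path : ∀ C {a b} → AdjAvoid H₀ (cut C) a b → Star (AdjAvoid G₀ C) (lift a) (lift b)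
    cut-path C (j , j∉ , joins) = route-avoiding (index σ j) (joins↑ j joins)
      (λ ∈C → j∉ (∈-⁻¹⁺ redirected (∈-redirect edge-lift (fsuc fzero) fzero j (inj₁ ∈C))))
      (λ eq ∈C → j∉ (∈-⁻¹⁺ redirected (∈-redirect edge-lift (fsuc fzero) fzero j (inj₂ (eq , ∈C)))))
      where
      redirected : Fin (length (E H₀)) → Fin (length (E G₀))
      redirected = redirect edge-lift (fsuc fzero) fzero C

  simulation : Simulation G₀ H₀
  simulation = record
    { vertex       = lift
    ; egg          = egg
    ; egg-isEgg    = egg-isEgg
    ; vertex-∈-egg = lift-∈-egg
    ; hitter       = hitter
    ; ∣hitter∣≤    = λ T → ∣f⁻¹q∣≤∣q∣ (redirect-injective v u T (Finₚ.punchIn-injective u _ _) (Finₚ.punchInᵢ≢i u))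
    ; hitter-hits  = hitter-hits
    ; cut          = cut
    ; ∣cut∣≤       = λ C → ∣f⁻¹q∣≤∣q∣
                       (redirect-injective (fsuc fzero) fzero C (index-injective σ ∘ Finₚ.suc-injective) (λ _ ()))
    ; cut-path     = cut-path
    }

sn-step : Step G H → SnAtLeast H m → SnAtLeast G m
sn-step (delEdge es i)   = sn-deleteEdge es i
sn-step (delVertex es v) = sn-deleteVertex es v
sn-step (smooth es es′ u v w e₁ e₂ _ _ _ e₁-uv e₂-uw _ es↭) =
  sn-reorder es↭ ∘ sn-simulation (Smoothing.simulation es′ e₁-uv e₂-uw)

sn-topMinor : ProperTopMinor G H → SnAtLeast H m → SnAtLeast G m
sn-topMinor [ step ]       = sn-step step
sn-topMinor (step ∷ minor) = sn-step step ∘ sn-topMinor minor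

-- Sweeping a scramble

Separates : (G : Graph) → Subset (length (E G)) → (Fin (V G) → Bool) → Set
Separates G C s = ∀ {j x y} → j ∉ C → Joins (lookup (E G) j) x y → s x ≡ s y

VertexSeparates : (G : Graph) → Subset (V G) → (Fin (V G) → Bool) → Set
VertexSeparates G T s = ∀ {j x y} → Joins (lookup (E G) j) x y → x ∉ T → y ∉ T → s x ≡ s y

OnSide : (Fin n → Bool) → Bool → Subset n → Set
OnSide s b Z = ∀ {x} → x ∈ Z → s x ≡ b

onSide? : ∀ (s : Fin n → Bool) b → Decidable (OnSide s b)
onSide? s b Z = Dec.map′ (λ h {x} → h x) (λ h x → h) (Finₚ.all? (λ x → x ∈? Z →-dec s x Boolₚ.≟ b))

meets : ∀ {T Z : Subset n} → ¬ (∀ {x} → x ∈ Z → x ∉ T) → ∃ λ x → x ∈ T × x ∈ Z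
meets {T = T} {Z} ¬avoids with Finₚ.any? (λ x → x ∈? T ×-dec x ∈? Z)
... | yes found = found
... | no  none  = ⊥-elim (¬avoids (λ x∈Z x∈T → none (_ , x∈T , x∈Z)))

side-constant-on-egg : ∀ {Z T s} → IsEgg G Z → VertexSeparates G T s → (∀ {x} → x ∈ Z → x ∉ T) →
  ∃ λ b → OnSide s b Z
side-constant-on-egg {s = s} ((z , z∈) , connected) separates avoids =
  s z , λ x∈ → sym (Star.fold (λ a b → s a ≡ s b)
    (λ (a∈ , b∈ , _ , joins) → trans (separates joins (avoids a∈) (avoids b∈))) refl (connected z∈ x∈))

first-jump : ∀ {Q : ℕ → Set} → Decidable Q → ∀ {lo hi} → lo ≤ hi → ¬ Q lo → Q hi →
  ∃ λ i → lo ≤ i × i < hi × ¬ Q i × Q (suc i)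
first-jump Q? {hi = zero}  z≤n    ¬Qlo Qhi = ⊥-elim (¬Qlo Qhi)
first-jump Q? {hi = suc h} lo≤hi ¬Qlo Qhi with m≤n⇒m<n∨m≡n lo≤hi
... | inj₂ refl = ⊥-elim (¬Qlo Qhi)
... | inj₁ (s≤s lo≤h) with Q? h
...   | no ¬Qh = h , lo≤h , ≤-refl , ¬Qh , Qhi
...   | yes Qh with first-jump Q? lo≤h ¬Qlo Qh
...     | i , lo≤i , i<h , ¬Qi , Qi+1 = i , lo≤i , ≤-trans i<h (n≤1+n h) , ¬Qi , Qi+1

module _ {G : Graph} {𝒮 : List (Subset (V G))} {m : ℕ} (scramble : IsScramble G 𝒮) (order : OrderAtLeast G 𝒮 m) where

  cut-separating-eggs : ∀ {C s Z₁ Z₂} → Z₁ ∈ₗ 𝒮 → Z₂ ∈ₗ 𝒮 → Separates G C s →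
    OnSide s true Z₁ → OnSide s false Z₂ → m ≤ ∣ C ∣
  cut-separating-eggs {C} {s} Z₁∈ Z₂∈ separates on-true on-false = proj₂ order C (_ , _ , Z₁∈ , Z₂∈ , disconnected)
    where
    disconnected : ∀ {x y} → x ∈ _ → y ∈ _ → ¬ Star (AdjAvoid G C) x y
    disconnected x∈ y∈ path with trans (sym (on-true x∈))
      (trans (Star.fold (λ a b → s a ≡ s b) (λ (_ , j∉ , joins) → trans (separates j∉ joins)) refl path) (on-false y∈))
    ... | ()

  hitting-set : ∀ {T} → (∀ {Z} → Z ∈ₗ 𝒮 → ¬ (∀ {x} → x ∈ Z → x ∉ T)) → m ≤ ∣ T ∣
  hitting-set {T} meets-all = proj₁ order T (All.tabulate (λ Z∈ → meets (meets-all Z∈)))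

  no-egg-across-cut : ∀ {C s Z} → ∣ C ∣ < m → Separates G C s → Any (OnSide s true) 𝒮 → Z ∈ₗ 𝒮 → ¬ OnSide s false Z
  no-egg-across-cut C<m separates some-egg Z∈ on-false with find some-egg
  ... | Z₁ , Z₁∈ , on-true = <⇒≱ C<m (cut-separating-eggs Z₁∈ Z∈ separates on-true on-false)

  -- As P i is cut off by fewer than m edges, no egg lies on its true side while another lies on its
  -- false side. Hence no egg lies on the true side of P lo, some egg on that of P hi, and where an egg
  -- first appears on the true side every egg meets the step set T.
  sweep : (P : ℕ → Fin (V G) → Bool) {lo hi : ℕ} → lo ≤ hi →
    (∀ {i} → lo ≤ i → i ≤ hi → ∃ λ C → ∣ C ∣ < m × Separates G C (P i)) →
    (∃ λ T → ∣ T ∣ < m × ∀ {x} → P lo x ≡ true → x ∈ T) →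
    (∃ λ T → ∣ T ∣ < m × ∀ {x} → P hi x ≡ false → x ∈ T) →
    (∀ {i} → lo ≤ i → i < hi → ∃ λ T → ∣ T ∣ < m × VertexSeparates G T (P i) ×
                                   ∀ {x} → x ∉ T → P (suc i) x ≡ true → P i x ≡ true) →
    ⊥
  sweep P {lo} {hi} lo≤hi cuts (Tlo , Tlo<m , ⊇true) (Thi , Thi<m , ⊇false) steps
    with first-jump (λ i → Any.any? (onSide? (P i) true) 𝒮) lo≤hi none-at-lo some-at-hi
    where
    none-at-lo : ¬ Any (OnSide (P lo) true) 𝒮
    none-at-lo some-egg with cuts ≤-refl lo≤hi
    ... | C , C<m , separates = <⇒≱ Tlo<m (hitting-set λ Z∈ avoids →
          no-egg-across-cut C<m separates some-egg Z∈ (λ x∈ → ¬-not (avoids x∈ ∘ ⊇true)))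
    some-at-hi : Any (OnSide (P hi) true) 𝒮
    some-at-hi with Any.any? (onSide? (P hi) true) 𝒮
    ... | yes some-egg = some-egg
    ... | no  no-egg   = ⊥-elim (<⇒≱ Thi<m (hitting-set λ Z∈ avoids →
          no-egg (lose Z∈ (λ x∈ → ¬-not (avoids x∈ ∘ ⊇false)))))
  ... | i , lo≤i , i<hi , none-at-i , some-at-i+1 with steps lo≤i i<hi | cuts (≤-trans lo≤i (n≤1+n i)) i<hi
  ...   | T , T<m , T-separates , monotone | C , C<m , separates = <⇒≱ T<m (hitting-set meets-T)
    where
    meets-T : ∀ {Z} → Z ∈ₗ 𝒮 → ¬ (∀ {x} → x ∈ Z → x ∉ T)
    meets-T Z∈ avoids with side-constant-on-egg {G = G} (All.lookup scramble Z∈) T-separates avoids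
    ... | true  , on-true  = none-at-i (lose Z∈ on-true)
    ... | false , on-false = no-egg-across-cut C<m separates some-at-i+1 Z∈
          (λ x∈ → ¬-not (λ eq → not-¬ (monotone (avoids x∈) eq) (on-false x∈)))

-- The graph C̃

toℕ-next : ∀ (j : Fin n) → suc (toℕ j) < n → toℕ (next j) ≡ suc (toℕ j)
toℕ-next {suc n} j j+1<n with suc (toℕ j) <? suc n
... | yes j+1<n′ = Finₚ.toℕ-fromℕ< j+1<n′
... | no  j+1≮n  = ⊥-elim (j+1≮n j+1<n)

toℕ-next-last : ∀ (j : Fin n) → suc (toℕ j) ≡ n → toℕ (next j) ≡ 0
toℕ-next-last {suc n} j j+1≡n with suc (toℕ j) <? suc n
... | yes j+1<n = ⊥-elim (<-irrefl j+1≡n j+1<n)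
... | no  _     = refl

last-vertex : Fin n → ∃ λ (last : Fin n) → suc (toℕ last) ≡ n
last-vertex {suc n} _ = fromℕ n , cong suc (Finₚ.toℕ-fromℕ n)

predecessor : ∀ (u : Fin n) → ∃ λ p → next p ≡ u
predecessor {suc n} fzero    = fromℕ n , Finₚ.toℕ-injective (toℕ-next-last (fromℕ n) (cong suc (Finₚ.toℕ-fromℕ n)))
predecessor {suc n} (fsuc t) =
  inject₁ t , Finₚ.toℕ-injective (trans (toℕ-next (inject₁ t) t+1<n) (cong suc (Finₚ.toℕ-inject₁ t)))
  where
  t+1<n : suc (toℕ (inject₁ t)) < suc n
  t+1<n = s≤s (subst (_< n) (sym (Finₚ.toℕ-inject₁ t)) (Finₚ.toℕ<n t))

next≢ : 2 ≤ n → ∀ (j : Fin n) → next j ≢ j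
next≢ {n} 2≤n j next≡j with suc (toℕ j) <? n
... | yes j+1<n = 1+n≢n (trans (sym (toℕ-next j j+1<n)) (cong toℕ next≡j))
... | no  j+1≮n = 1+n≰n (subst (λ m → 2 ≤ suc m) j≡0 (subst (2 ≤_) (sym j+1≡n) 2≤n))
  where
  j+1≡n : suc (toℕ j) ≡ n
  j+1≡n = ≤-antisym (Finₚ.toℕ<n j) (≮⇒≥ j+1≮n)
  j≡0 : toℕ j ≡ 0
  j≡0 = trans (sym (cong toℕ next≡j)) (toℕ-next-last j j+1≡n)

2*k≡k+k : ∀ k → 2 * k ≡ k + k
2*k≡k+k k = cong (k +_) (+-identityʳ k)

2k+2≤n : ∀ {k} → 2 ≤ k → 3 * k ≤ n → 2 * k + 2 ≤ n
2k+2≤n {n} {k} 2≤k 3k≤n =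
  ≤-trans (+-monoʳ-≤ (2 * k) 2≤k) (subst (_≤ n) (trans (*-distribʳ-+ k 2 1) (cong (2 * k +_) (*-identityˡ k))) 3k≤n)

mult-thick : ∀ k (j : Fin n) → toℕ j < 2 * k → mult k j ≡ suc k
mult-thick k j j<2k with toℕ j <? 2 * k
... | yes _    = refl
... | no j≮2k  = ⊥-elim (j≮2k j<2k)

mult-thin : ∀ k (j : Fin n) → ¬ toℕ j < 2 * k → mult k j ≡ k
mult-thin k j j≮2k with toℕ j <? 2 * k
... | yes j<2k = ⊥-elim (j≮2k j<2k)
... | no _     = refl

k≤mult : ∀ k (j : Fin n) → k ≤ mult k j
k≤mult k j with toℕ j <? 2 * k
... | yes _ = n≤1+n k
... | no _  = ≤-refl

mult≤1+k : ∀ k (j : Fin n) → mult k j ≤ suc k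
mult≤1+k k j with toℕ j <? 2 * k
... | yes _ = ≤-refl
... | no _  = n≤1+n k

module Bundles (n k : ℕ) where

  private
    es : List (Fin n × Fin n)
    es = E (Ctilde n k)

  source : Fin (length es) → Fin n
  source e = proj₁ (lookup es e)

  edge-shape : ∀ e → lookup es e ≡ (source e , next (source e))
  edge-shape e = cong (source e ,_) (All.lookup shapes (∈-lookup e))
    where
    shapes : All (λ e → proj₂ e ≡ next (proj₁ e)) es
    shapes = Allₚ.concat⁺ (Allₚ.map⁺ (All.universal (λ j → Allₚ.replicate⁺ (mult k j) refl) (allFin n)))

  bundle : Fin n → Subset (length es)
  bundle j = setOf (λ e → source e Finₚ.≟ j)

  ∈-bundle⁺ : ∀ {e j} → source e ≡ j → e ∈ bundle j
  ∈-bundle⁺ {j = j} = ∈-setOf⁺ (λ e → source e Finₚ.≟ j)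

  ∈-bundle⁻ : ∀ {e j} → e ∈ bundle j → source e ≡ j
  ∈-bundle⁻ {j = j} = ∈-setOf⁻ (λ e → source e Finₚ.≟ j)

  ∣bundle∣ : ∀ j → ∣ bundle j ∣ ≡ mult k j
  ∣bundle∣ j = begin
    ∣ bundle j ∣                                   ≡⟨ ∣setOf-lookup∣≡length-filter (λ e → proj₁ e Finₚ.≟ j) es ⟩
    length (filter from-j es)                      ≡⟨ cong (length ∘ filter from-j ∘ concat) (map-tabulate id block) ⟩
    length (filter from-j (concat (tabulate block))) ≡⟨ cong length (filter-concat-single from-j block j others) ⟩
    length (filter from-j (block j))               ≡⟨ cong length (filter-all from-j (Allₚ.replicate⁺ (mult k j) refl)) ⟩
    length (block j)                               ≡⟨ length-replicate (mult k j) ⟩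
    mult k j                                       ∎
    where
    open ≡-Reasoning
    from-j : (e : Fin n × Fin n) → Dec (proj₁ e ≡ j)
    from-j e = proj₁ e Finₚ.≟ j
    block : Fin n → List (Fin n × Fin n)
    block i = replicate (mult k i) (i , next i)
    others : ∀ i → i ≢ j → filter from-j (block i) ≡ []
    others i i≢j = filter-none from-j (Allₚ.replicate⁺ (mult k i) i≢j)

  ∣bundle∪bundle∣ : ∀ {a c} → a ≢ c → ∣ bundle a ∪ bundle c ∣ ≡ mult k a + mult k c
  ∣bundle∪bundle∣ {a} {c} a≢c = begin
    ∣ bundle a ∪ bundle c ∣     ≡⟨ disjoint⇒∣p∪q∣≡∣p∣+∣q∣ (bundle a) (bundle c) disjoint ⟩
    ∣ bundle a ∣ + ∣ bundle c ∣ ≡⟨ cong₂ _+_ (∣bundle∣ a) (∣bundle∣ c) ⟩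
    mult k a + mult k c         ∎
    where
    open ≡-Reasoning
    disjoint : Empty (bundle a ∩ bundle c)
    disjoint (e , e∈) with x∈p∩q⁻ (bundle a) (bundle c) e∈
    ... | e∈a , e∈c = a≢c (trans (sym (∈-bundle⁻ e∈a)) (∈-bundle⁻ e∈c))

  k+k≤degree : 2 ≤ n → ∀ u → k + k ≤ length (filter (λ e → touches? e u) es)
  k+k≤degree 2≤n u with predecessor u
  ... | p , next-p≡u = begin
    k + k                                      ≤⟨ +-mono-≤ (k≤mult k u) (k≤mult k p) ⟩
    mult k u + mult k p                        ≡⟨ ∣bundle∪bundle∣ (λ u≡p → next≢ 2≤n p (trans next-p≡u u≡p)) ⟨
    ∣ bundle u ∪ bundle p ∣                    ≤⟨ p⊆q⇒∣p∣≤∣q∣ incident ⟩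
    ∣ setOf (λ e → touches? (lookup es e) u) ∣ ≡⟨ ∣setOf-lookup∣≡length-filter (λ e → touches? e u) es ⟩
    length (filter (λ e → touches? e u) es)    ∎
    where
    open ≤-Reasoning
    target≡u : ∀ {e} → e ∈ bundle p → proj₂ (lookup es e) ≡ u
    target≡u {e} e∈ = trans (cong proj₂ (edge-shape e)) (trans (cong next (∈-bundle⁻ e∈)) next-p≡u)
    incident : bundle u ∪ bundle p ⊆ setOf (λ e → touches? (lookup es e) u)
    incident e∈ = ∈-setOf⁺ (λ e → touches? (lookup es e) u)
      ([ inj₁ ∘ ∈-bundle⁻ , inj₂ ∘ target≡u ]′ (x∈p∪q⁻ (bundle u) (bundle p) e∈))

  module _ (C : Subset (length es)) where

    open-edge : ∀ {j} → ¬ bundle j ⊆ C → AdjAvoid (Ctilde n k) C j (next j)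
    open-edge {j} not-full = e , e∉C , inj₁ (trans (edge-shape e) (cong (λ z → z , next z) (∈-bundle⁻ e∈)))
      where
      uncut : ∃ λ e → ¬ (e ∈ bundle j → e ∈ C)
      uncut = Finₚ.¬∀⟶∃¬ _ _ (λ e → e ∈? bundle j →-dec e ∈? C) (λ full → not-full (full _))
      e : Fin (length es)
      e = proj₁ uncut
      e∉C : e ∉ C
      e∉C e∈C = proj₂ uncut (λ _ → e∈C)
      e∈ : e ∈ bundle j
      e∈ = decidable-stable (e ∈? bundle j) (λ e∉ → proj₂ uncut (⊥-elim ∘ e∉))

    forward-path : ∀ {x y} → toℕ x ≤ toℕ y → (∀ {j} → toℕ x ≤ toℕ j → toℕ j < toℕ y → ¬ bundle j ⊆ C) →
      Star (AdjAvoid (Ctilde n k) C) x y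
    forward-path {x} {y} x≤y = go (toℕ y ∸ toℕ x) (m+[n∸m]≡n x≤y)
      where
      go : ∀ d {x} → toℕ x + d ≡ toℕ y → (∀ {j} → toℕ x ≤ toℕ j → toℕ j < toℕ y → ¬ bundle j ⊆ C) →
        Star (AdjAvoid (Ctilde n k) C) x y
      go zero    {x} x+0≡y _     = subst (Star _ x) (Finₚ.toℕ-injective (trans (sym (+-identityʳ _)) x+0≡y)) ε
      go (suc d) {x} x+d≡y opens =
        open-edge (opens ≤-refl x<y) ◅ go d next-x+d≡y (λ x+1≤j → opens (≤-trans (n≤1+n _) (subst (_≤ _) next-x≡ x+1≤j)))
        where
        x<y : toℕ x < toℕ y
        x<y = subst (toℕ x <_) x+d≡y (m<m+n (toℕ x) z<s)
        next-x≡ : toℕ (next x) ≡ suc (toℕ x)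
        next-x≡ = toℕ-next x (≤-<-trans x<y (Finₚ.toℕ<n y))
        next-x+d≡y : toℕ (next x) + d ≡ toℕ y
        next-x+d≡y = trans (cong (_+ d) next-x≡) (trans (sym (+-suc (toℕ x) d)) x+d≡y)

    wrap-path : ∀ {x y} → (∀ {j} → toℕ j < toℕ x ⊎ toℕ y ≤ toℕ j → ¬ bundle j ⊆ C) →
      Star (AdjAvoid (Ctilde n k) C) y x
    wrap-path {x} {y} opens with last-vertex y
    ... | last , last+1≡n =
      forward-path y≤last (λ y≤j _ → opens (inj₂ y≤j)) Star.◅◅
      open-edge (opens (inj₂ y≤last)) ◅
      forward-path (subst (_≤ toℕ x) (sym (toℕ-next-last last last+1≡n)) z≤n) (λ _ j<x → opens (inj₁ j<x))
      where
      y≤last : toℕ y ≤ toℕ last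
      y≤last = ≤-pred (subst (toℕ y <_) (sym last+1≡n) (Finₚ.toℕ<n y))

    -- Each of the two arcs between x and y contains a bundle lying entirely in C.
    separated-positions : ∀ {x y} → toℕ x < toℕ y → toℕ y ≤ 2 * k → ¬ Star (AdjAvoid (Ctilde n k) C) x y →
      suc (2 * k) ≤ ∣ C ∣
    separated-positions {x} {y} x<y y≤2k disconnected
      with Finₚ.any? (λ j → (toℕ x ≤? toℕ j ×-dec toℕ j <? toℕ y) ×-dec bundle j ⊆? C)
         | Finₚ.any? (λ j → (toℕ j <? toℕ x ⊎-dec toℕ y ≤? toℕ j) ×-dec bundle j ⊆? C)
    ... | no none | _ = ⊥-elim (disconnected (forward-path (<⇒≤ x<y) λ x≤j j<y full → none (_ , (x≤j , j<y) , full)))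
    ... | _ | no none = ⊥-elim (disconnected
                          (Star.reverse (AdjAvoid-sym {G = Ctilde n k}) (wrap-path λ out full → none (_ , out , full))))
    ... | yes (j₁ , (x≤j₁ , j₁<y) , full₁) | yes (j₂ , j₂-outside , full₂) = begin
      suc (2 * k)               ≡⟨ cong suc (2*k≡k+k k) ⟩
      suc k + k                 ≤⟨ +-mono-≤ (≤-reflexive (sym (mult-thick k j₁ (<-≤-trans j₁<y y≤2k)))) (k≤mult k j₂) ⟩
      mult k j₁ + mult k j₂     ≡⟨ ∣bundle∪bundle∣ j₁≢j₂ ⟨
      ∣ bundle j₁ ∪ bundle j₂ ∣ ≤⟨ p⊆q⇒∣p∣≤∣q∣ (λ e∈ → [ full₁ , full₂ ]′ (x∈p∪q⁻ (bundle j₁) (bundle j₂) e∈)) ⟩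
      ∣ C ∣                     ∎
      where
      open ≤-Reasoning
      j₁≢j₂ : j₁ ≢ j₂
      j₁≢j₂ refl = [ (λ j₁<x → <⇒≱ j₁<x x≤j₁) , (λ y≤j₁ → <⇒≱ j₁<y y≤j₁) ]′ j₂-outside

  sn≥2k+1 : 2 * k < n → SnAtLeast (Ctilde n k) (suc (2 * k))
  sn≥2k+1 2k<n = tabulate ⁅ι⁆ , Allₚ.tabulate⁺ (λ i → singleton-isEgg {G = Ctilde n k} (ι i)) , hitting , cutting
    where
    ι : Fin (suc (2 * k)) → Fin n
    ι i = inject≤ i 2k<n
    ⁅ι⁆ : Fin (suc (2 * k)) → Subset n
    ⁅ι⁆ i = ⁅ ι i ⁆
    ι≤2k : ∀ i → toℕ (ι i) ≤ 2 * k
    ι≤2k i = ≤-trans (≤-reflexive (Finₚ.toℕ-inject≤ i 2k<n)) (≤-pred (Finₚ.toℕ<n i))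
    hitting : ∀ T → Hits T (tabulate ⁅ι⁆) → suc (2 * k) ≤ ∣ T ∣
    hitting T hits = begin
      suc (2 * k)             ≡⟨ ∣⊤∣≡n (suc (2 * k)) ⟨
      ∣ ⊤ {n = suc (2 * k)} ∣ ≤⟨ injectiveOn⇒∣p∣≤∣q∣ {p = ⊤} ι (λ _ _ → ι-injective) (λ _ → ι-hit _) ⟩
      ∣ T ∣                   ∎
      where
      open ≤-Reasoning
      ι-injective : ∀ {i j} → ι i ≡ ι j → i ≡ j
      ι-injective = Finₚ.inject≤-injective 2k<n 2k<n _ _
      ι-hit : ∀ i → ι i ∈ T
      ι-hit i with Allₚ.tabulate⁻ {f = ⁅ι⁆} hits i
      ... | x , x∈T , x∈⁅ιi⁆ = subst (_∈ T) (x∈⁅y⁆⇒x≡y (ι i) x∈⁅ιi⁆) x∈T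
    cutting : ∀ C → IsEggCut (Ctilde n k) (tabulate ⁅ι⁆) C → suc (2 * k) ≤ ∣ C ∣
    cutting C (_ , _ , Z₁∈ , Z₂∈ , separated) with ∈-tabulate⁻ {f = ⁅ι⁆} Z₁∈ | ∈-tabulate⁻ {f = ⁅ι⁆} Z₂∈
    ... | i , refl | j , refl with <-cmp (toℕ (ι i)) (toℕ (ι j))
    ...   | tri< ιi<ιj _ _ = separated-positions C ιi<ιj (ι≤2k j) (separated (x∈⁅x⁆ (ι i)) (x∈⁅x⁆ (ι j)))
    ...   | tri> _ _ ιj<ιi = separated-positions C ιj<ιi (ι≤2k i)
                               (separated (x∈⁅x⁆ (ι i)) (x∈⁅x⁆ (ι j)) ∘ Star.reverse (AdjAvoid-sym {G = Ctilde n k}))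
    ...   | tri≈ _ ιi≡ιj _ =
      ⊥-elim (separated (x∈⁅x⁆ (ι i)) (subst (_∈ ⁅ ι j ⁆) (sym (Finₚ.toℕ-injective ιi≡ιj)) (x∈⁅x⁆ (ι j))) ε)

-- Deleting an edge of C̃

-- rot x is the position of x along the cycle when counting starts at next b, so that b comes last.
module Rotation {n : ℕ} (b : Fin n) where

  private
    B : ℕ
    B = toℕ b
    N′ : ℕ
    N′ = n ∸ suc B
    N′+B+1≡n : N′ + suc B ≡ n
    N′+B+1≡n = m∸n+n≡m (Finₚ.toℕ<n b)

  rot : Fin n → ℕ
  rot x with B <? toℕ x
  ... | yes _ = toℕ x ∸ suc B
  ... | no _  = toℕ x + N′

  rot-after : ∀ {x} → B < toℕ x → rot x + suc B ≡ toℕ x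
  rot-after {x} B<x with B <? toℕ x
  ... | yes _  = m∸n+n≡m B<x
  ... | no B≮x = ⊥-elim (B≮x B<x)

  rot-before : ∀ {x} → toℕ x ≤ B → rot x ≡ toℕ x + N′
  rot-before {x} x≤B with B <? toℕ x
  ... | yes B<x = ⊥-elim (<⇒≱ B<x x≤B)
  ... | no _    = refl

  rot-after<N′ : ∀ {x} → B < toℕ x → rot x < N′
  rot-after<N′ {x} B<x =
    +-cancelʳ-< (suc B) (rot x) N′ (subst₂ _<_ (sym (rot-after B<x)) (sym N′+B+1≡n) (Finₚ.toℕ<n x))

  rot<n : ∀ x → rot x < n
  rot<n x with toℕ x ≤? B
  ... | no x≰B  = ≤-trans (rot-after<N′ (≰⇒> x≰B)) (m∸n≤m n (suc B))
  ... | yes x≤B = subst₂ _<_ (sym (rot-before x≤B)) (trans (+-comm (suc B) N′) N′+B+1≡n) (+-monoˡ-< N′ (s≤s x≤B))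

  rot-injective : ∀ {x y} → rot x ≡ rot y → x ≡ y
  rot-injective {x} {y} eq with toℕ x ≤? B | toℕ y ≤? B
  ... | no x≰B  | no y≰B  =
    Finₚ.toℕ-injective (trans (sym (rot-after (≰⇒> x≰B))) (trans (cong (_+ suc B) eq) (rot-after (≰⇒> y≰B))))
  ... | yes x≤B | yes y≤B =
    Finₚ.toℕ-injective (+-cancelʳ-≡ N′ _ _ (trans (sym (rot-before x≤B)) (trans eq (rot-before y≤B))))
  ... | no x≰B  | yes y≤B =
    ⊥-elim (<⇒≱ (rot-after<N′ (≰⇒> x≰B)) (subst (N′ ≤_) (trans (sym (rot-before y≤B)) (sym eq)) (m≤n+m N′ (toℕ y))))
  ... | yes x≤B | no y≰B  =
    ⊥-elim (<⇒≱ (rot-after<N′ (≰⇒> y≰B)) (subst (N′ ≤_) (trans (sym (rot-before x≤B)) eq) (m≤n+m N′ (toℕ x))))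

  rot-next : ∀ {x} → x ≢ b → rot (next x) ≡ suc (rot x)
  rot-next {x} x≢b with suc (toℕ x) <? n | toℕ x ≤? B
  ... | yes x+1<n | no x≰B = +-cancelʳ-≡ (suc B) _ _ (begin
    rot (next x) + suc B ≡⟨ rot-after (subst (B <_) (sym next≡) (≤-trans (≰⇒> x≰B) (n≤1+n _))) ⟩
    toℕ (next x)         ≡⟨ next≡ ⟩
    suc (toℕ x)          ≡⟨ cong suc (rot-after (≰⇒> x≰B)) ⟨
    suc (rot x) + suc B  ∎)
    where
    open ≡-Reasoning
    next≡ : toℕ (next x) ≡ suc (toℕ x)
    next≡ = toℕ-next x x+1<n
  ... | yes x+1<n | yes x≤B = begin
    rot (next x)         ≡⟨ rot-before (subst (_≤ B) (sym next≡) (≤∧≢⇒< x≤B (x≢b ∘ Finₚ.toℕ-injective))) ⟩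
    toℕ (next x) + N′    ≡⟨ cong (_+ N′) next≡ ⟩
    suc (toℕ x) + N′     ≡⟨ cong suc (rot-before x≤B) ⟨
    suc (rot x)          ∎
    where
    open ≡-Reasoning
    next≡ : toℕ (next x) ≡ suc (toℕ x)
    next≡ = toℕ-next x x+1<n
  ... | no x+1≮n | no x≰B = begin
    rot (next x)         ≡⟨ rot-before (subst (_≤ B) (sym next≡0) z≤n) ⟩
    toℕ (next x) + N′    ≡⟨ cong (_+ N′) next≡0 ⟩
    N′                   ≡⟨ +-cancelʳ-≡ (suc B) _ _ (trans N′+B+1≡n (trans (sym x+1≡n) (cong suc (sym rx+B+1≡x)))) ⟩
    suc (rot x)          ∎
    where
    open ≡-Reasoning
    x+1≡n : suc (toℕ x) ≡ n
    x+1≡n = ≤-antisym (Finₚ.toℕ<n x) (≮⇒≥ x+1≮n)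
    next≡0 : toℕ (next x) ≡ 0
    next≡0 = toℕ-next-last x x+1≡n
    rx+B+1≡x : rot x + suc B ≡ toℕ x
    rx+B+1≡x = rot-after (≰⇒> x≰B)
  ... | no x+1≮n | yes x≤B =
    ⊥-elim (x≢b (Finₚ.toℕ-injective (≤-antisym x≤B (≤-pred (subst (B <_) x+1≡n (Finₚ.toℕ<n b))))))
    where
    x+1≡n : n ≡ suc (toℕ x)
    x+1≡n = sym (≤-antisym (Finₚ.toℕ<n x) (≮⇒≥ x+1≮n))

  rot-next-b : rot (next b) ≡ 0
  rot-next-b with suc B <? n
  ... | yes B+1<n = +-cancelʳ-≡ (suc B) _ 0 (trans (rot-after (subst (B <_) (sym next≡) ≤-refl)) next≡)
    where
    next≡ : toℕ (next b) ≡ suc B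
    next≡ = toℕ-next b B+1<n
  ... | no B+1≮n = begin
    rot (next b)      ≡⟨ rot-before (subst (_≤ B) (sym next≡0) z≤n) ⟩
    toℕ (next b) + N′ ≡⟨ cong (_+ N′) next≡0 ⟩
    n ∸ suc B         ≡⟨ cong (n ∸_) B+1≡n ⟩
    n ∸ n             ≡⟨ n∸n≡0 n ⟩
    0                 ∎
    where
    open ≡-Reasoning
    B+1≡n : suc B ≡ n
    B+1≡n = ≤-antisym (Finₚ.toℕ<n b) (≮⇒≥ B+1≮n)
    next≡0 : toℕ (next b) ≡ 0
    next≡0 = toℕ-next-last b B+1≡n

module EdgeDeletion (k n : ℕ) (2≤k : 2 ≤ k) (2k+2≤n : 2 * k + 2 ≤ n) (idx : Fin (length (E (Ctilde n k)))) where

  open Bundles n k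

  private
    es : List (Fin n × Fin n)
    es = E (Ctilde n k)
    σ : Embedding _≡_ (removeAt es idx) es
    σ = Sublist⇒Embedding (removeAt-Sublist es idx)
    1≤k : 1 ≤ k
    1≤k = ≤-trans (s≤s z≤n) 2≤k

  G∖e : Graph
  G∖e = mkGraph n (removeAt es idx)

  b : Fin n
  b = source idx

  open Rotation b

  side : ℕ → Fin n → Bool
  side i x = does (rot x ≤? i)

  side≡true⇒ : ∀ {i x} → side i x ≡ true → rot x ≤ i
  side≡true⇒ {i} {x} = does≡true⇒ (rot x ≤? i)

  side≡false⇒ : ∀ {i x} → side i x ≡ false → i < rot x
  side≡false⇒ {i} {x} = ≰⇒> ∘ does≡false⇒ (rot x ≤? i)

  side-next : ∀ {i x} → x ≢ b → rot x ≢ i → side i x ≡ side i (next x)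
  side-next {i} {x} x≢b rx≢i = does-⇔
    (mk⇔ (λ rx≤i → subst (_≤ i) (sym (rot-next x≢b)) (≤∧≢⇒< rx≤i rx≢i))
         (λ rnx≤i → <⇒≤ (subst (_≤ i) (rot-next x≢b) rnx≤i)))
    (rot x ≤? i) (rot (next x) ≤? i)

  remaining-edge-shape : ∀ j → lookup (E G∖e) j ≡ (source (index σ j) , next (source (index σ j)))
  remaining-edge-shape j = trans (lookup-index σ j) (edge-shape (index σ j))

  side-along-edge : ∀ {i j x y} → Joins (lookup (E G∖e) j) x y →
    source (index σ j) ≢ b → rot (source (index σ j)) ≢ i → side i x ≡ side i y
  side-along-edge {j = j} joins a≢b ra≢i with Joins-pair (subst (λ e → Joins e _ _) (remaining-edge-shape j) joins)
  ... | inj₁ (refl , refl) = side-next a≢b ra≢i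
  ... | inj₂ (refl , refl) = sym (side-next a≢b ra≢i)

  crosses? : ∀ i (e : Fin n × Fin n) → Dec (proj₁ e ≡ b ⊎ rot (proj₁ e) ≡ i)
  crosses? i e = (proj₁ e Finₚ.≟ b) ⊎-dec (rot (proj₁ e) ≟ i)

  cut : ℕ → Subset (length (E G∖e))
  cut i = setOf (crosses? i ∘ lookup (E G∖e))

  cut-separates : ∀ i → Separates G∖e (cut i) (side i)
  cut-separates i {j} j∉ joins = side-along-edge joins (j∉ ∘ crossing ∘ inj₁) (j∉ ∘ crossing ∘ inj₂)
    where
    crossing : source (index σ j) ≡ b ⊎ rot (source (index σ j)) ≡ i → j ∈ cut i
    crossing = ∈-setOf⁺ (crosses? i ∘ lookup (E G∖e))
             ∘ subst (λ e → proj₁ e ≡ b ⊎ rot (proj₁ e) ≡ i) (sym (remaining-edge-shape j))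

  ∣crossing∣≤ : ∀ i → (∀ q → rot q ≡ i → mult k b + mult k q ≤ suc (2 * k)) →
    ∣ setOf (crosses? i ∘ lookup es) ∣ ≤ suc (2 * k)
  ∣crossing∣≤ i bound with Finₚ.any? (λ q → rot q ≟ i)
  ... | yes (q , rq≡i) = begin
    ∣ setOf (crosses? i ∘ lookup es) ∣ ≤⟨ p⊆q⇒∣p∣≤∣q∣ (λ e∈ → x∈p∪q⁺ (Sum.map ∈-bundle⁺ (∈-bundle⁺ ∘ same-position)
                                                        (∈-setOf⁻ (crosses? i ∘ lookup es) e∈))) ⟩
    ∣ bundle b ∪ bundle q ∣            ≤⟨ ∣p∪q∣≤∣p∣+∣q∣ (bundle b) (bundle q) ⟩
    ∣ bundle b ∣ + ∣ bundle q ∣        ≡⟨ cong₂ _+_ (∣bundle∣ b) (∣bundle∣ q) ⟩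
    mult k b + mult k q                ≤⟨ bound q rq≡i ⟩
    suc (2 * k)                        ∎
    where
    open ≤-Reasoning
    same-position : ∀ {x} → rot x ≡ i → x ≡ q
    same-position rx≡i = rot-injective (trans rx≡i (sym rq≡i))
  ... | no none = begin
    ∣ setOf (crosses? i ∘ lookup es) ∣ ≤⟨ p⊆q⇒∣p∣≤∣q∣ (λ {e} e∈ → [ ∈-bundle⁺ , ⊥-elim ∘ none ∘ (source e ,_) ]′
                                                        (∈-setOf⁻ (crosses? i ∘ lookup es) e∈)) ⟩
    ∣ bundle b ∣                       ≡⟨ ∣bundle∣ b ⟩
    mult k b                           ≤⟨ mult≤1+k k b ⟩
    suc k                              ≤⟨ s≤s (m≤m+n k (k + 0)) ⟩
    suc (2 * k)                        ∎
    where open ≤-Reasoning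

  ∣cut∣< : ∀ i → (∀ q → rot q ≡ i → mult k b + mult k q ≤ suc (2 * k)) → ∣ cut i ∣ < suc (2 * k)
  ∣cut∣< i bound = begin-strict
    ∣ cut i ∣                                      ≡⟨ ∣setOf-lookup∣≡length-filter (crosses? i) (removeAt es idx) ⟩
    length (filter (crosses? i) (removeAt es idx)) <⟨ ≤-reflexive (length-filter-removeAt (crosses? i) es idx e∈) ⟩
    length (filter (crosses? i) es)                ≡⟨ ∣setOf-lookup∣≡length-filter (crosses? i) es ⟨
    ∣ setOf (crosses? i ∘ lookup es) ∣             ≤⟨ ∣crossing∣≤ i bound ⟩
    suc (2 * k)                                    ∎
    where
    open ≤-Reasoning
    e∈ : proj₁ (lookup es idx) ≡ b ⊎ rot (proj₁ (lookup es idx)) ≡ i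
    e∈ = inj₁ refl

  fiber : ℕ → Subset n
  fiber c = setOf (λ x → rot x ≟ c)

  ∣fiber∣≤1 : ∀ c → ∣ fiber c ∣ ≤ 1
  ∣fiber∣≤1 c = injectiveLabels⇒∣p∣≤ (λ _ → 0)
    (λ x∈ y∈ _ → rot-injective (trans (∈-setOf⁻ (λ x → rot x ≟ c) x∈) (sym (∈-setOf⁻ (λ x → rot x ≟ c) y∈))))
    (λ _ → s≤s z≤n)

  boundary : ℕ → Subset n
  boundary i = fiber 0 ∪ fiber (suc i)

  ∣boundary∣≤2 : ∀ i → ∣ boundary i ∣ ≤ 2
  ∣boundary∣≤2 i = ≤-trans (∣p∪q∣≤∣p∣+∣q∣ (fiber 0) (fiber (suc i))) (+-mono-≤ (∣fiber∣≤1 0) (∣fiber∣≤1 (suc i)))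

  boundary-separates : ∀ i → VertexSeparates G∖e (boundary i) (side i)
  boundary-separates i {j} joins x∉ y∉ = side-along-edge {i} {j} joins a≢b ra≢i
    where
    a : Fin n
    a = source (index σ j)
    next-a∉ : next a ∉ boundary i
    next-a∉ with Joins-pair (subst (λ e → Joins e _ _) (remaining-edge-shape j) joins)
    ... | inj₁ (_ , refl) = y∉
    ... | inj₂ (refl , _) = x∉
    a≢b : a ≢ b
    a≢b a≡b = next-a∉ (x∈p∪q⁺ (inj₁ (∈-setOf⁺ (λ x → rot x ≟ 0) (subst (λ z → rot (next z) ≡ 0) (sym a≡b) rot-next-b))))
    ra≢i : rot a ≢ i
    ra≢i ra≡i = next-a∉ (x∈p∪q⁺ (inj₂ (∈-setOf⁺ (λ x → rot x ≟ suc i) (trans (rot-next a≢b) (cong suc ra≡i)))))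

  side-outside-boundary : ∀ {i x} → x ∉ boundary i → side (suc i) x ≡ true → side i x ≡ true
  side-outside-boundary {i} {x} x∉ eq = dec-true (rot x ≤? i) (≤-pred (≤∧≢⇒< (side≡true⇒ {suc i} {x} eq)
    (λ rx≡i+1 → x∉ (x∈p∪q⁺ (inj₂ (∈-setOf⁺ (λ x → rot x ≟ suc i) rx≡i+1))))))

  ∣rot≤∣ : ∀ c → ∣ setOf (λ x → rot x ≤? c) ∣ ≤ suc c
  ∣rot≤∣ c = injectiveLabels⇒∣p∣≤ rot (λ _ _ → rot-injective) (s≤s ∘ ∈-setOf⁻ (λ x → rot x ≤? c))

  ∣rot>∣ : ∀ c → ∣ setOf (λ x → c <? rot x) ∣ ≤ n ∸ suc c
  ∣rot>∣ c = injectiveLabels⇒∣p∣≤ (λ x → rot x ∸ suc c)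
    (λ x∈ y∈ eq → rot-injective (trans (sym (m∸n+n≡m (above x∈))) (trans (cong (_+ suc c) eq) (m∸n+n≡m (above y∈)))))
    (λ {x} x∈ → ∸-monoˡ-< (rot<n x) (above x∈))
    where
    above : ∀ {x} → x ∈ setOf (λ x → c <? rot x) → suc c ≤ rot x
    above = ∈-setOf⁻ (λ x → c <? rot x)

  no-scramble-by-sweep : ∀ {lo hi} → lo ≤ hi → lo < 2 * k → n ≤ suc hi + 2 * k →
    (∀ q → lo ≤ rot q → rot q ≤ hi → mult k b + mult k q ≤ suc (2 * k)) → ¬ SnAtLeast G∖e (suc (2 * k))
  no-scramble-by-sweep {lo} {hi} lo≤hi lo<2k n≤hi+1+2k bound (𝒮 , scramble , order) =
    sweep {G = G∖e} scramble order side lo≤hi cuts (setOf (λ x → rot x ≤? lo) , ∣lo-side∣<m , lo-side)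
      (setOf (λ x → hi <? rot x) , ∣hi-side∣<m , hi-side) steps
    where
    cuts : ∀ {i} → lo ≤ i → i ≤ hi → ∃ λ C → ∣ C ∣ < suc (2 * k) × Separates G∖e C (side i)
    cuts {i} lo≤i i≤hi = cut i , ∣cut∣< i bound′ , cut-separates i
      where
      bound′ : ∀ q → rot q ≡ i → mult k b + mult k q ≤ suc (2 * k)
      bound′ q rq≡i = bound q (subst (lo ≤_) (sym rq≡i) lo≤i) (subst (_≤ hi) (sym rq≡i) i≤hi)
    ∣lo-side∣<m : ∣ setOf (λ x → rot x ≤? lo) ∣ < suc (2 * k)
    ∣lo-side∣<m = s≤s (≤-trans (∣rot≤∣ lo) lo<2k)
    lo-side : ∀ {x} → side lo x ≡ true → x ∈ setOf (λ x → rot x ≤? lo)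
    lo-side {x} = ∈-setOf⁺ (λ x → rot x ≤? lo) ∘ side≡true⇒ {lo} {x}
    ∣hi-side∣<m : ∣ setOf (λ x → hi <? rot x) ∣ < suc (2 * k)
    ∣hi-side∣<m = s≤s (≤-trans (∣rot>∣ hi) (m≤n+o⇒m∸n≤o n (suc hi) n≤hi+1+2k))
    hi-side : ∀ {x} → side hi x ≡ false → x ∈ setOf (λ x → hi <? rot x)
    hi-side {x} = ∈-setOf⁺ (λ x → hi <? rot x) ∘ side≡false⇒ {hi} {x}
    steps : ∀ {i} → lo ≤ i → i < hi → ∃ λ T → ∣ T ∣ < suc (2 * k) × VertexSeparates G∖e T (side i) ×
                                          ∀ {x} → x ∉ T → side (suc i) x ≡ true → side i x ≡ true
    steps {i} _ _ = boundary i , s≤s (≤-trans (∣boundary∣≤2 i) (*-monoʳ-≤ 2 1≤k)) , boundary-separates i ,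
                    side-outside-boundary

  thin-case : ¬ toℕ b < 2 * k → ¬ SnAtLeast G∖e (suc (2 * k))
  thin-case b≮2k = no-scramble-by-sweep {0} {n ∸ 2} z≤n 0<2k n≤ bound
    where
    0<2k : 0 < 2 * k
    0<2k = ≤-trans 1≤k (m≤m+n k _)
    n≤ : n ≤ suc (n ∸ 2) + 2 * k
    n≤ = begin
      n                   ≡⟨ m∸n+n≡m (≤-trans (m≤n+m 2 (2 * k)) 2k+2≤n) ⟨
      n ∸ 2 + 2           ≡⟨ +-suc (n ∸ 2) 1 ⟩
      suc (n ∸ 2) + 1     ≤⟨ +-monoʳ-≤ (suc (n ∸ 2)) 0<2k ⟩
      suc (n ∸ 2) + 2 * k ∎
      where open ≤-Reasoning
    bound : ∀ q → 0 ≤ rot q → rot q ≤ n ∸ 2 → mult k b + mult k q ≤ suc (2 * k)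
    bound q _ _ = begin
      mult k b + mult k q ≤⟨ +-mono-≤ (≤-reflexive (mult-thin k b b≮2k)) (mult≤1+k k q) ⟩
      k + suc k           ≡⟨ +-suc k k ⟩
      suc (k + k)         ≡⟨ cong suc (2*k≡k+k k) ⟨
      suc (2 * k)         ∎
      where open ≤-Reasoning

  -- k edges remain at b, so a cut at a thick bundle would have 2k+1 edges: the sweep only runs over the
  -- arcs ending at the thin bundles after b.
  thick-case : toℕ b < 2 * k → ¬ SnAtLeast G∖e (suc (2 * k))
  thick-case b<2k = no-scramble-by-sweep {lo} {hi} lo≤hi lo<2k n≤ bound
    where
    B lo hi : ℕ
    B = toℕ b
    lo = 2 * k ∸ suc B
    hi = n ∸ suc (suc B)
    lo+B+1≡2k : lo + suc B ≡ 2 * k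
    lo+B+1≡2k = m∸n+n≡m b<2k
    hi+B+2≡n : suc hi + suc B ≡ n
    hi+B+2≡n = trans (sym (+-suc hi (suc B)))
      (m∸n+n≡m (≤-trans (s≤s b<2k) (≤-trans (n≤1+n _) (subst (_≤ n) (+-comm (2 * k) 2) 2k+2≤n))))
    lo<2k : lo < 2 * k
    lo<2k = subst (lo <_) lo+B+1≡2k (m<m+n lo z<s)
    lo≤hi : lo ≤ hi
    lo≤hi = ≤-pred (+-cancelʳ-≤ (suc B) (suc lo) (suc hi) (subst₂ _≤_ (sym (cong suc lo+B+1≡2k)) (sym hi+B+2≡n)
      (subst (_≤ n) (+-comm (2 * k) 1) (≤-trans (+-monoʳ-≤ (2 * k) (s≤s z≤n)) 2k+2≤n))))
    n≤ : n ≤ suc hi + 2 * k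
    n≤ = subst (_≤ suc hi + 2 * k) hi+B+2≡n (+-monoʳ-≤ (suc hi) b<2k)
    after-b : ∀ {q} → rot q ≤ hi → B < toℕ q
    after-b {q} rq≤hi = ≰⇒> λ q≤b → <⇒≱ (s≤s rq≤hi) (begin
      suc hi                 ≡⟨ m+n∸n≡m (suc hi) (suc B) ⟨
      suc hi + suc B ∸ suc B ≡⟨ cong (_∸ suc B) hi+B+2≡n ⟩
      n ∸ suc B              ≤⟨ m≤n+m (n ∸ suc B) (toℕ q) ⟩
      toℕ q + (n ∸ suc B)    ≡⟨ rot-before q≤b ⟨
      rot q                  ∎)
      where open ≤-Reasoning
    bound : ∀ q → lo ≤ rot q → rot q ≤ hi → mult k b + mult k q ≤ suc (2 * k)
    bound q lo≤rq rq≤hi =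
      ≤-reflexive (trans (cong₂ _+_ (mult-thick k b b<2k) (mult-thin k q q≮2k)) (cong suc (sym (2*k≡k+k k))))
      where
      q≮2k : ¬ toℕ q < 2 * k
      q≮2k q<2k = <⇒≱ q<2k (subst₂ _≤_ lo+B+1≡2k (rot-after (after-b rq≤hi)) (+-monoˡ-≤ (suc B) lo≤rq))

  no-large-scramble : ¬ SnAtLeast G∖e (suc (2 * k))
  no-large-scramble with toℕ b <? 2 * k
  ... | yes b<2k = thick-case b<2k
  ... | no  b≮2k = thin-case b≮2k

sn-drops-after-step : ∀ {k H} → 2 ≤ k → 2 * k + 2 ≤ n → Step (Ctilde n k) H → ¬ SnAtLeast H (suc (2 * k))
sn-drops-after-step {n} {k} 2≤k 2k+2≤n (delEdge _ i) = EdgeDeletion.no-large-scramble k n 2≤k 2k+2≤n i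
sn-drops-after-step {suc n} {k} 2≤k 2k+2≤n (delVertex _ v) =
  EdgeDeletion.no-large-scramble k (suc n) 2≤k 2k+2≤n i ∘ sn-deleteVertex (removeAt es i) v ∘
    subst (λ es′ → SnAtLeast (mkGraph n es′) _) (sym (dropVertex-removeAt v es i (inj₁ (∈-bundle⁻ i∈))))
  where
  open Bundles (suc n) k
  es : List (Fin (suc n) × Fin (suc n))
  es = E (Ctilde (suc n) k)
  edge-at-v : Nonempty (bundle v)
  edge-at-v = 0<∣p∣⇒nonempty (bundle v)
    (subst (0 <_) (sym (∣bundle∣ v)) (≤-trans (≤-trans (s≤s z≤n) 2≤k) (k≤mult k v)))
  i : Fin (length es)
  i = proj₁ edge-at-v
  i∈ : i ∈ bundle v
  i∈ = proj₂ edge-at-v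
sn-drops-after-step {n} {k} 2≤k 2k+2≤n (smooth _ es′ u _ _ e₁ e₂ _ _ _ _ _ untouched es↭) _ =
  <⇒≱ degree≤2 (Bundles.k+k≤degree n k (≤-trans (m≤n+m 2 (2 * k)) 2k+2≤n) u)
  where
  degree≤2 : length (filter (λ e → touches? e u) (E (Ctilde n k))) < k + k
  degree≤2 = begin-strict
    length (filter (λ e → touches? e u) (E (Ctilde n k))) ≡⟨ ↭-length (filter-↭ (λ e → touches? e u) es↭) ⟩
    length (filter (λ e → touches? e u) (e₁ ∷ e₂ ∷ es′))  ≤⟨ length-filter-pair (λ e → touches? e u) e₁ e₂ untouched ⟩
    2                                                     <⟨ s≤s (s≤s (s≤s z≤n)) ⟩
    4                                                     ≤⟨ +-mono-≤ 2≤k 2≤k ⟩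
    k + k                                                 ∎
    where open ≤-Reasoning

lemma4p2 : (k n : ℕ) → 2 ≤ k → 3 * k ≤ n → ScrambleMinimal (suc (2 * k)) (Ctilde n k)
lemma4p2 k n 2≤k 3k≤n = Bundles.sn≥2k+1 n k (<-≤-trans (m<m+n (2 * k) z<s) 2k+2≤n′) , λ _ → no-scramble
  where
  2k+2≤n′ : 2 * k + 2 ≤ n
  2k+2≤n′ = 2k+2≤n 2≤k 3k≤n
  no-scramble : ∀ {H} → ProperTopMinor (Ctilde n k) H → ¬ SnAtLeast H (suc (2 * k))
  no-scramble [ step ]       = sn-drops-after-step 2≤k 2k+2≤n′ step
  no-scramble (step ∷ minor) = sn-drops-after-step 2≤k 2k+2≤n′ step ∘ sn-topMinor minor
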